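{- Let $\xi(G,x,y,z)$ denote the unique function from finite multigraphs to $\mathbb{Z}[x,y,z]$ satisfying: $\xi(G)=\xi(G_{ -e})+y\cdot\xi(G_{/e})+z\cdot\xi(G_{\dagger e})$ for every multigraph $G$ and every edge $e$ of $G$; $\xi(G_1\oplus G_2)=\xi(G_1)\xi(G_2)$; $\xi(E_1)=x$; $\xi(\emptyset)=1$. Then for every finite multigraph $G=(V,E)$, $$\xi(G,x,y,z)=\sum_{(A\sqcup B)\subseteq E} x^{k(A\sqcup B)-k_{cov}(B)}\, y^{|A|+|B|-k_{cov}(B)}\, z^{k_{cov}(B)}.$$
   Context: Multigraphs are finite, loops and multiple edges allowed. For an edge $e$: $G_{ -e}$ removes $e$; $G_{/e}$ identifies the endpoints of $e$ (removing $e$; may create loops and multiple edges); $G_{\dagger e}$ is the subgraph induced by $V\setminus\{u,v\}$ where $e=\{u,v\}$. $G_1\oplus G_2$ is disjoint union, $E_1$ is the one-vertex edgeless graph, $\emptyset$ the graph with no vertices. For $S\subseteq E$, $V(S)$ is the set of vertices covered by (incident to) edges of $S$. The sum ranges over all pairs $(A,B)$ of subsets of $E$ with $V(A)\cap V(B)=\emptyset$ (written $A\sqcup B$). $k(A\sqcup B)$ is the number of connected components of the spanning subgraph $(V,A\cup B)$, and $k_{cov}(B)$ is the number of connected components of the graph $(V(B),B)$. -}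

module Defs where

open import Data.Nat as ℕ using (ℕ; zero; suc; _+_; _∸_; _≤?_)
open import Data.Fin as Fin using (Fin; zero; suc; punchOut; _↑ˡ_; _↑ʳ_; toℕ)
open import Data.Fin.Properties using (_≟_)
open import Data.Bool using (Bool; true; false; _∧_; _∨_; not; if_then_else_)
open import Data.List as List using (List; []; _∷_; length; removeAt; lookup; _++_; map; foldr; concatMap)
open import Data.Vec as Vec using (Vec; []; _∷_)
open import Data.Product using (_×_; _,_; proj₁; proj₂)
open import Relation.Nullary using (yes; no)
open import Relation.Nullary.Decidable using (⌊_⌋)
open import Relation.Binary.PropositionalEquality using (_≢_; sym)
open import Algebra.Bundles using (CommutativeRing)

-- Finite multigraphs (loops and parallel edges allowed).
-- Vertices are Fin nV; edges are a list of (unordered) endpoint pairs;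
-- the i-th list entry is edge i.  A pair (u , u) is a loop.

record Graph : Set where
  constructor mkG
  field
    nV    : ℕ
    edges : List (Fin nV × Fin nV)
open Graph public

Edge : Graph → Set
Edge G = Fin (length (edges G))

E₁ : Graph
E₁ = mkG 1 []

G∅ : Graph
G∅ = mkG 0 []

_⊕_ : Graph → Graph → Graph
mkG n₁ es₁ ⊕ mkG n₂ es₂ =
  mkG (n₁ + n₂)
      (map (λ p → (proj₁ p ↑ˡ n₂) , (proj₂ p ↑ˡ n₂)) es₁
       ++ map (λ p → (n₁ ↑ʳ proj₁ p) , (n₁ ↑ʳ proj₂ p)) es₂)

delete : (G : Graph) → Edge G → Graph
delete (mkG n es) e = mkG n (removeAt es e)

-- G_{/e} : identify v with u (v removed, remaining vertices reindexed);
-- for a loop this is just deletion of e.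
mergeV : ∀ {k} (u v : Fin (suc k)) → u ≢ v → Fin (suc k) → Fin k
mergeV u v u≢v w with v ≟ w
... | yes _   = punchOut {i = v} {j = u} (λ eq → u≢v (sym eq))
... | no v≢w = punchOut v≢w

mergeG : (n : ℕ) → List (Fin n × Fin n) → Fin n → Fin n → Graph
mergeG zero    es () v
mergeG (suc k) es u v with u ≟ v
... | yes _   = mkG (suc k) es
... | no u≢v = mkG k (map (λ p → mergeV u v u≢v (proj₁ p) , mergeV u v u≢v (proj₂ p)) es)

contract : (G : Graph) → Edge G → Graph
contract (mkG n es) e =
  mergeG n (removeAt es e) (proj₁ (lookup es e)) (proj₂ (lookup es e))

-- G_{†e} : subgraph induced by V ∖ {u , v}
removeVertex : ∀ {k} → List (Fin (suc k) × Fin (suc k)) → Fin (suc k)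
             → List (Fin k × Fin k)
removeVertex []             w = []
removeVertex ((a , b) ∷ es) w with w ≟ a | w ≟ b
... | no w≢a | no w≢b = (punchOut w≢a , punchOut w≢b) ∷ removeVertex es w
... | _      | _      = removeVertex es w

daggerG : (n : ℕ) → List (Fin n × Fin n) → Fin n → Fin n → Graph
daggerG zero    es () v
daggerG (suc k) es u v with u ≟ v
... | yes _   = mkG k (removeVertex es u)
daggerG (suc zero)    es u v | no u≢v with punchOut u≢v
... | ()
daggerG (suc (suc k)) es u v | no u≢v =
  mkG k (removeVertex (removeVertex es u) (punchOut u≢v))

dagger : (G : Graph) → Edge G → Graph
dagger (mkG n es) e = daggerG n es (proj₁ (lookup es e)) (proj₂ (lookup es e))

selected : ∀ {X : Set} (es : List X) → Vec Bool (length es) → List X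
selected []       []       = []
selected (e ∷ es) (b ∷ bs) = if b then e ∷ selected es bs else selected es bs

allSubsets : (m : ℕ) → List (Vec Bool m)
allSubsets zero    = [] ∷ []
allSubsets (suc m) = concatMap (λ s → (false ∷ s) ∷ (true ∷ s) ∷ []) (allSubsets m)

anyL : ∀ {X : Set} → (X → Bool) → List X → Bool
anyL p = foldr (λ a r → p a ∨ r) false

allV : ∀ {n} → (Fin n → Bool) → Bool
allV {n} p = Vec.foldr _ _∧_ true (Vec.tabulate p)

countV : ∀ {n} → (Fin n → Bool) → ℕ
countV {n} p = Vec.foldr _ (λ b r → (if b then 1 else 0) + r) 0 (Vec.tabulate p)

covered : ∀ {n} → List (Fin n × Fin n) → Vec Bool n
covered es = Vec.tabulate (λ w → anyL (λ p → ⌊ w ≟ proj₁ p ⌋ ∨ ⌊ w ≟ proj₂ p ⌋) es)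

disjointV : ∀ {n} → Vec Bool n → Vec Bool n → Bool
disjointV S T = allV (λ w → not (Vec.lookup S w ∧ Vec.lookup T w))

step : ∀ {n} → List (Fin n × Fin n) → Vec Bool n → Vec Bool n
step es R = Vec.tabulate (λ w → Vec.lookup R w ∨
  anyL (λ p → (Vec.lookup R (proj₁ p) ∧ ⌊ w ≟ proj₂ p ⌋)
            ∨ (Vec.lookup R (proj₂ p) ∧ ⌊ w ≟ proj₁ p ⌋)) es)

iterateN : ∀ {X : Set} → ℕ → (X → X) → X → X
iterateN zero    f a = a
iterateN (suc k) f a = f (iterateN k f a)

-- vertices joined to v by a walk with at most n edges (= its component)
reach : ∀ {n} → List (Fin n × Fin n) → Fin n → Vec Bool n
reach {n} es v = iterateN n (step es) (Vec.tabulate (λ w → ⌊ w ≟ v ⌋))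

isRep : ∀ {n} → List (Fin n × Fin n) → Fin n → Bool
isRep es v = allV (λ u → not (Vec.lookup (reach es v) u) ∨ ⌊ toℕ v ≤? toℕ u ⌋)

-- number of connected components of the spanning subgraph (V , es)
kSpan : ∀ {n} → List (Fin n × Fin n) → ℕ
kSpan es = countV (isRep es)

-- number of connected components of (V(es) , es)
kCov : ∀ {n} → List (Fin n × Fin n) → ℕ
kCov es = countV (λ v → Vec.lookup (covered es) v ∧ isRep es v)

module Expansion {c ℓ} (R : CommutativeRing c ℓ) where
  open CommutativeRing R renaming (_+_ to _+ᴿ_)

  pow : Carrier → ℕ → Carrier
  pow a zero    = 1#
  pow a (suc k) = a * pow a k

  ringSum : List Carrier → Carrier
  ringSum = foldr _+ᴿ_ 0#

  term : Carrier → Carrier → Carrier → (G : Graph)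
       → Vec Bool (length (edges G)) → Vec Bool (length (edges G)) → Carrier
  term x y z (mkG n es) A B =
    let EA = selected es A
        EB = selected es B
        kc = kCov EB
    in if disjointV (covered EA) (covered EB)
       then pow x (kSpan (EA ++ EB) ∸ kc)
            * pow y (length EA + length EB ∸ kc)
            * pow z kc
       else 0#

  subgraphSum : Carrier → Carrier → Carrier → Graph → Carrier
  subgraphSum x y z G =
    ringSum (concatMap (λ A → map (λ B → term x y z G A B)
                                  (allSubsets (length (edges G))))
                       (allSubsets (length (edges G))))

module Submission where

-- Write S(G) for the sum over pairs A ⊔ B ⊆ E with
-- V(A) ∩ V(B) = ∅ of x^{k(A⊔B)-kcov(B)} y^{|A|+|B|-kcov(B)} z^{kcov(B)}.  We show that
-- S satisfies ξ's recurrence at the first edge e of every graph and that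
-- S(G) = x^|V| = ξ(G) for edgeless G; induction on the number of edges gives ξ = S.
--
-- The recurrence is checked pair by pair.  Pairs with e ∉ A ∪ B are the pairs of G_{-e};
-- pairs with e on both sides vanish, and so do the pairs in which e and the other side
-- share an endpoint.  Pairs with e ∈ A, and pairs with e ∈ B where B ∖ e touches an
-- endpoint of e, become after identifying the endpoints exactly the pairs of G_{/e};
-- they carry an extra factor y, as the components stay the same but there is one more
-- edge.  The remaining pairs, e ∈ B with A ∪ B ∖ e avoiding both endpoints, are the
-- pairs of G_{†e} with e added as a new covered component: an extra factor z.

open import Defs
open import Algebra.Bundles using (CommutativeRing)
open import Data.Nat using (zero; suc)
open import Data.Fin using (zero)
open import Data.List using ([]; _∷_)
open import Data.Product using (_,_)

module Components where

  open import Data.Nat as ℕ using (ℕ; zero; suc; _+_; _≤_; z≤n; s≤s; _≤?_)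
  import Data.Nat.Properties as ℕP
  open import Data.Fin as Fin using (Fin; zero; suc; toℕ; punchIn; punchOut)
  open import Data.Fin.Properties
    using (_≟_; toℕ-injective; punchOut-cong; punchOut-injective; punchIn-punchOut; punchOut-punchIn; punchInᵢ≢i)
  open import Data.Bool using (Bool; true; false; _∧_; _∨_; not)
  open import Data.Bool.Properties using (∧-comm; ∧-zeroʳ; ∧-identityʳ; ∨-assoc)
  open import Data.Product using (_×_; _,_; proj₁; proj₂; Σ; ∃-syntax)
  open import Data.Sum using (_⊎_; inj₁; inj₂)
  open import Data.Empty using (⊥; ⊥-elim)
  open import Data.List using (List; []; _∷_; _++_; map; length)
  open import Data.List.Properties using (length-map)
  open import Data.List.Membership.Propositional using (_∈_)
  open import Data.List.Membership.Propositional.Properties using (∈-map⁺; ∈-map⁻; ∈-++⁺ˡ; ∈-++⁺ʳ; ∈-++⁻)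
  open import Data.List.Relation.Unary.Any using (here; there)
  import Data.Vec as Vec
  open import Data.Vec.Properties using (lookup∘tabulate)
  open import Relation.Nullary using (Dec; yes; no; ¬_)
  open import Relation.Nullary.Decidable using (⌊_⌋)
  open import Relation.Binary.PropositionalEquality
  open import Relation.Binary.Construct.Closure.ReflexiveTransitive as Star using (Star; ε; _◅_; _◅◅_)

  EdgeList : ℕ → Set
  EdgeList n = List (Fin n × Fin n)

  true≢false : true ≢ false
  true≢false ()

  ∨-true-split : ∀ {a b} → a ∨ b ≡ true → (a ≡ true) ⊎ (b ≡ true)
  ∨-true-split {true}  e = inj₁ refl
  ∨-true-split {false} e = inj₂ e

  ∨-true-l : ∀ {a} b → a ≡ true → a ∨ b ≡ true
  ∨-true-l {true} b e = refl

  ∨-true-r : ∀ a {b} → b ≡ true → a ∨ b ≡ true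
  ∨-true-r true  e = refl
  ∨-true-r false e = e

  ∧-true-split : ∀ {a b} → a ∧ b ≡ true → (a ≡ true) × (b ≡ true)
  ∧-true-split {true} {true} e = refl , refl

  ∧-true-intro : ∀ {a b} → a ≡ true → b ≡ true → a ∧ b ≡ true
  ∧-true-intro refl refl = refl

  not-true : ∀ {b} → not b ≡ true → b ≡ false
  not-true {false} e = refl

  bool-ext : ∀ {b c : Bool} → (b ≡ true → c ≡ true) → (c ≡ true → b ≡ true) → b ≡ c
  bool-ext {true}  {true}  f g = refl
  bool-ext {true}  {false} f g = sym (f refl)
  bool-ext {false} {true}  f g = g refl
  bool-ext {false} {false} f g = refl

  anyL-true : ∀ {X : Set} (p : X → Bool) (L : List X) → anyL p L ≡ true → ∃[ x ] (x ∈ L × p x ≡ true)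
  anyL-true p (x ∷ L) e with ∨-true-split {p x} e
  ... | inj₁ px = x , here refl , px
  ... | inj₂ r with anyL-true p L r
  ... | y , m , py = y , there m , py

  anyL-intro : ∀ {X : Set} (p : X → Bool) {L : List X} {x} → x ∈ L → p x ≡ true → anyL p L ≡ true
  anyL-intro p {y ∷ L} (here refl) px = ∨-true-l _ px
  anyL-intro p {y ∷ L} (there m)   px = ∨-true-r (p y) (anyL-intro p m px)

  allV-true : ∀ {n} (p : Fin n → Bool) → allV p ≡ true → ∀ x → p x ≡ true
  allV-true {suc n} p e zero    = proj₁ (∧-true-split {p zero} e)
  allV-true {suc n} p e (suc x) = allV-true (λ y → p (suc y)) (proj₂ (∧-true-split {p zero} e)) x

  allV-intro : ∀ {n} (p : Fin n → Bool) → (∀ x → p x ≡ true) → allV p ≡ true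
  allV-intro {zero}  p f = refl
  allV-intro {suc n} p f = ∧-true-intro (f zero) (allV-intro (λ y → p (suc y)) (λ y → f (suc y)))

  eqb : ∀ {n} → Fin n → Fin n → Bool
  eqb a b = ⌊ a ≟ b ⌋

  eqb-refl : ∀ {n} (a : Fin n) → eqb a a ≡ true
  eqb-refl a with a ≟ a
  ... | yes _ = refl
  ... | no ne = ⊥-elim (ne refl)

  eqb-≢ : ∀ {n} {a b : Fin n} → a ≢ b → eqb a b ≡ false
  eqb-≢ {a = a} {b} ne with a ≟ b
  ... | yes e = ⊥-elim (ne e)
  ... | no _  = refl

  eqb-true : ∀ {n} {a b : Fin n} → eqb a b ≡ true → a ≡ b
  eqb-true {a = a} {b} e with a ≟ b
  ... | yes q = q

  eqb-false : ∀ {n} {a b : Fin n} → eqb a b ≡ false → a ≢ b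
  eqb-false {a = a} e refl = true≢false (trans (sym (eqb-refl a)) e)

  bit : Bool → ℕ
  bit true  = 1
  bit false = 0

  bit≤1 : ∀ b → bit b ≤ 1
  bit≤1 true  = s≤s z≤n
  bit≤1 false = z≤n

  countV-suc : ∀ {n} (p : Fin (suc n) → Bool) → countV p ≡ bit (p zero) + countV (λ x → p (suc x))
  countV-suc p with p zero
  ... | true  = refl
  ... | false = refl

  countV-cong : ∀ {n} {p q : Fin n → Bool} → (∀ x → p x ≡ q x) → countV p ≡ countV q
  countV-cong {zero}  e = refl
  countV-cong {suc n} {p} {q} e = begin
    countV p                                   ≡⟨ countV-suc p ⟩
    bit (p zero) + countV (λ x → p (suc x))    ≡⟨ cong₂ _+_ (cong bit (e zero)) (countV-cong (λ x → e (suc x))) ⟩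
    bit (q zero) + countV (λ x → q (suc x))    ≡⟨ countV-suc q ⟨
    countV q                                   ∎
    where open ≡-Reasoning

  countV-false : ∀ {n} (p : Fin n → Bool) → (∀ x → p x ≡ false) → countV p ≡ 0
  countV-false {zero}  p e = refl
  countV-false {suc n} p e = trans (countV-suc p) (cong₂ _+_ (cong bit (e zero)) (countV-false _ (λ x → e (suc x))))

  countV-true : ∀ {n} (p : Fin n → Bool) → (∀ x → p x ≡ true) → countV p ≡ n
  countV-true {zero}  p e = refl
  countV-true {suc n} p e = trans (countV-suc p) (cong₂ _+_ (cong bit (e zero)) (countV-true _ (λ x → e (suc x))))

  countV-≤n : ∀ {n} (p : Fin n → Bool) → countV p ≤ n
  countV-≤n {zero}  p = z≤n
  countV-≤n {suc n} p rewrite countV-suc p with p zero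
  ... | true  = s≤s (countV-≤n _)
  ... | false = ℕP.m≤n⇒m≤1+n (countV-≤n _)

  _⇒ᵇ_ : ∀ {n} → (Fin n → Bool) → (Fin n → Bool) → Set
  p ⇒ᵇ q = ∀ x → p x ≡ true → q x ≡ true

  bit-mono : ∀ {a b} → (a ≡ true → b ≡ true) → bit a ≤ bit b
  bit-mono {false} {b}     f = z≤n
  bit-mono {true}  {true}  f = s≤s z≤n
  bit-mono {true}  {false} f with f refl
  ... | ()

  countV-mono : ∀ {n} {p q : Fin n → Bool} → p ⇒ᵇ q → countV p ≤ countV q
  countV-mono {zero}  f = z≤n
  countV-mono {suc n} {p} {q} f rewrite countV-suc p | countV-suc q =
    ℕP.+-mono-≤ (bit-mono (f zero)) (countV-mono (λ x → f (suc x)))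

  countV-saturated : ∀ {n} {p q : Fin n → Bool} → p ⇒ᵇ q → countV q ≤ countV p → q ⇒ᵇ p
  countV-saturated {suc n} {p} {q} f le x qx rewrite countV-suc p | countV-suc q
    with p zero in eqp | q zero in eqq
  countV-saturated f le zero qx | true  | _     = eqp
  countV-saturated f le zero qx | false | true  =
    ⊥-elim (ℕP.<-irrefl refl (ℕP.≤-trans le (countV-mono (λ y → f (suc y)))))
  countV-saturated f le zero qx | false | false = ⊥-elim (true≢false (trans (sym qx) eqq))
  countV-saturated f le (suc x) qx | true  | true  = countV-saturated (λ y → f (suc y)) (ℕP.+-cancelˡ-≤ 1 _ _ le) x qx
  countV-saturated f le (suc x) qx | false | false = countV-saturated (λ y → f (suc y)) le x qx
  countV-saturated f le (suc x) qx | false | true  = countV-saturated (λ y → f (suc y)) (ℕP.m+n≤o⇒n≤o 1 le) x qx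
  countV-saturated f le (suc x) qx | true  | false = ⊥-elim (true≢false (trans (sym (f zero eqp)) eqq))

  countV-punchIn : ∀ {n} (v : Fin (suc n)) (p : Fin (suc n) → Bool) →
    countV p ≡ bit (p v) + countV (λ x → p (punchIn v x))
  countV-punchIn zero p = countV-suc p
  countV-punchIn {suc n} (suc v) p = begin
    countV p                                        ≡⟨ countV-suc p ⟩
    a + countV (λ x → p (suc x))                    ≡⟨ cong (a +_) (countV-punchIn v (λ x → p (suc x))) ⟩
    a + (b + rest)                                  ≡⟨ ℕP.+-assoc a b rest ⟨
    (a + b) + rest                                  ≡⟨ cong (_+ rest) (ℕP.+-comm a b) ⟩
    (b + a) + rest                                  ≡⟨ ℕP.+-assoc b a rest ⟩
    b + (a + rest)                                  ≡⟨ cong (b +_) (countV-suc (λ x → p (punchIn (suc v) x))) ⟨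
    b + countV (λ x → p (punchIn (suc v) x))        ∎
    where
    open ≡-Reasoning
    a = bit (p zero)
    b = bit (p (suc v))
    rest = countV (λ x → p (suc (punchIn v x)))

  countV-point : ∀ {n} (r : Fin n) (p : Fin n → Bool) →
    countV p ≡ bit (p r) + countV (λ x → p x ∧ not (eqb x r))
  countV-point {suc n} r p =
    trans (countV-punchIn r p) (cong (bit (p r) +_) (sym (trans (countV-punchIn r (λ x → p x ∧ not (eqb x r)))
      (cong₂ _+_ (cong bit (trans (cong (λ b → p r ∧ not b) (eqb-refl r)) (∧-zeroʳ (p r))))
        (countV-cong (λ x → trans (cong (λ b → p (punchIn r x) ∧ not b) (eqb-≢ (punchInᵢ≢i r x))) (∧-identityʳ _)))))))

  countV-split : ∀ {n} (p q : Fin n → Bool) →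
    countV p ≡ countV (λ x → p x ∧ q x) + countV (λ x → p x ∧ not (q x))
  countV-split {zero} p q = refl
  countV-split {suc n} p q rewrite countV-suc p | countV-suc (λ x → p x ∧ q x) | countV-suc (λ x → p x ∧ not (q x))
    | countV-split (λ x → p (suc x)) (λ x → q (suc x)) with p zero | q zero
  ... | true  | true  = refl
  ... | true  | false = sym (ℕP.+-suc _ _)
  ... | false | true  = refl
  ... | false | false = refl

  Adj : ∀ {n} → EdgeList n → Fin n → Fin n → Set
  Adj L a b = ((a , b) ∈ L) ⊎ ((b , a) ∈ L)

  Connected : ∀ {n} → EdgeList n → Fin n → Fin n → Set
  Connected L = Star (Adj L)

  adj-sym : ∀ {n} {L : EdgeList n} {a b} → Adj L a b → Adj L b a
  adj-sym (inj₁ x) = inj₂ x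
  adj-sym (inj₂ y) = inj₁ y

  conn-snoc : ∀ {n} {L : EdgeList n} {a b c} → Connected L a b → Adj L b c → Connected L a c
  conn-snoc p q = p ◅◅ (q ◅ ε)

  conn-sym : ∀ {n} {L : EdgeList n} {a b} → Connected L a b → Connected L b a
  conn-sym = Star.reverse adj-sym

  Sub : ∀ {n} → EdgeList n → EdgeList n → Set
  Sub L L' = ∀ {p} → p ∈ L → p ∈ L'

  conn-sub : ∀ {n} {L L' : EdgeList n} → Sub L L' → ∀ {x y} → Connected L x y → Connected L' x y
  conn-sub s = Star.map λ { (inj₁ m) → inj₁ (s m) ; (inj₂ m) → inj₂ (s m) }

  stepFn : ∀ {n} → EdgeList n → (Fin n → Bool) → Fin n → Bool
  stepFn es r w = r w ∨ anyL (λ p → (r (proj₁ p) ∧ eqb w (proj₂ p)) ∨ (r (proj₂ p) ∧ eqb w (proj₁ p))) es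

  reachIn : ∀ {n} → EdgeList n → Fin n → ℕ → Fin n → Bool
  reachIn es v k = Vec.lookup (iterateN k (step es) (Vec.tabulate (λ w → eqb w v)))

  reachIn-zero : ∀ {n} (es : EdgeList n) v w → reachIn es v zero w ≡ eqb w v
  reachIn-zero es v w = lookup∘tabulate _ w

  reachIn-suc : ∀ {n} (es : EdgeList n) v k w → reachIn es v (suc k) w ≡ stepFn es (reachIn es v k) w
  reachIn-suc es v k w = lookup∘tabulate _ w

  stepFn-sound : ∀ {n} (es : EdgeList n) v (r : Fin n → Bool) → (∀ w → r w ≡ true → Connected es v w) →
    ∀ w → stepFn es r w ≡ true → Connected es v w
  stepFn-sound es v r h w e with ∨-true-split {r w} e
  ... | inj₁ rw = h w rw
  ... | inj₂ a with anyL-true _ es a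
  ... | (p , q) , m , t with ∨-true-split {r p ∧ eqb w q} t
  ... | inj₁ t1 with ∧-true-split {r p} t1
  ... | rp , wq rewrite eqb-true {a = w} wq = conn-snoc (h p rp) (inj₁ m)
  stepFn-sound es v r h w e | inj₂ a | (p , q) , m , t | inj₂ t2 with ∧-true-split {r q} t2
  ... | rq , wp rewrite eqb-true {a = w} wp = conn-snoc (h q rq) (inj₂ m)

  reachIn-sound : ∀ {n} (es : EdgeList n) v k w → reachIn es v k w ≡ true → Connected es v w
  reachIn-sound es v zero w e rewrite reachIn-zero es v w | eqb-true {a = w} e = ε
  reachIn-sound es v (suc k) w e rewrite reachIn-suc es v k w =
    stepFn-sound es v (reachIn es v k) (reachIn-sound es v k) w e

  -- Completeness: the approximations grow until they are closed under steps, which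
  -- happens after at most n steps because each proper growth adds a vertex.

  stepFn-mono : ∀ {n} (es : EdgeList n) {r r'} → r ⇒ᵇ r' → stepFn es r ⇒ᵇ stepFn es r'
  stepFn-mono es {r} {r'} f w e with ∨-true-split {r w} e
  ... | inj₁ rw = ∨-true-l _ (f w rw)
  ... | inj₂ a with anyL-true _ es a
  ... | (p , q) , m , t = ∨-true-r (r' w) (anyL-intro _ m (lift t))
    where
    lift : ((r p ∧ eqb w q) ∨ (r q ∧ eqb w p)) ≡ true → ((r' p ∧ eqb w q) ∨ (r' q ∧ eqb w p)) ≡ true
    lift t with ∨-true-split {r p ∧ eqb w q} t
    ... | inj₁ t1 = ∨-true-l _ (∧-true-intro (f p (proj₁ (∧-true-split {r p} t1))) (proj₂ (∧-true-split {r p} t1)))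
    ... | inj₂ t2 = ∨-true-r (r' p ∧ eqb w q) (∧-true-intro (f q (proj₁ (∧-true-split {r q} t2))) (proj₂ (∧-true-split {r q} t2)))

  reachIn-grows : ∀ {n} (es : EdgeList n) v k → reachIn es v k ⇒ᵇ reachIn es v (suc k)
  reachIn-grows es v k w e rewrite reachIn-suc es v k w = ∨-true-l _ e

  reachIn-from-start : ∀ {n} (es : EdgeList n) v k → reachIn es v zero ⇒ᵇ reachIn es v k
  reachIn-from-start es v zero    w e = e
  reachIn-from-start es v (suc k) w e = reachIn-grows es v k w (reachIn-from-start es v k w e)

  Closed : ∀ {n} → EdgeList n → (Fin n → Bool) → Set
  Closed es r = stepFn es r ⇒ᵇ r

  closed-suc : ∀ {n} (es : EdgeList n) v k → Closed es (reachIn es v k) → Closed es (reachIn es v (suc k))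
  closed-suc es v k c w e =
    reachIn-grows es v k w (c w (stepFn-mono es {reachIn es v (suc k)} {reachIn es v k}
      (λ x ex → c x (subst (_≡ true) (reachIn-suc es v k x) ex)) w e))

  reachIn-closed-or-large : ∀ {n} (es : EdgeList n) v k → Closed es (reachIn es v k) ⊎ (suc k ≤ countV (reachIn es v k))
  reachIn-closed-or-large es v zero
    rewrite countV-point v (reachIn es v zero) | reachIn-zero es v v | eqb-refl v = inj₂ (s≤s z≤n)
  reachIn-closed-or-large es v (suc k) with reachIn-closed-or-large es v k
  ... | inj₁ c = inj₁ (closed-suc es v k c)
  ... | inj₂ le with countV (reachIn es v (suc k)) ≤? countV (reachIn es v k)
  ... | yes le' = inj₁ (closed-suc es v k (λ w e → countV-saturated (reachIn-grows es v k) le' w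
                                                    (subst (_≡ true) (sym (reachIn-suc es v k w)) e)))
  ... | no nle  = inj₂ (ℕP.≤-trans (s≤s le) (ℕP.≰⇒> nle))

  reach-closed : ∀ {n} (es : EdgeList n) v → Closed es (reachIn es v n)
  reach-closed {n} es v with reachIn-closed-or-large es v n
  ... | inj₁ c  = c
  ... | inj₂ le = ⊥-elim (ℕP.<-irrefl refl (ℕP.≤-trans le (countV-≤n _)))

  reach-sound : ∀ {n} (es : EdgeList n) v w → Vec.lookup (reach es v) w ≡ true → Connected es v w
  reach-sound {n} es v w = reachIn-sound es v n w

  reach-complete : ∀ {n} (es : EdgeList n) v w → Connected es v w → Vec.lookup (reach es v) w ≡ true
  reach-complete {n} es v w c = walk c (reachIn-from-start es v n v (trans (reachIn-zero es v v) (eqb-refl v)))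
    where
    walk : ∀ {a} → Connected es a w → reachIn es v n a ≡ true → reachIn es v n w ≡ true
    walk ε e = e
    walk (inj₁ m ◅ c) e = walk c (reach-closed es v _
      (∨-true-r (reachIn es v n _) (anyL-intro _ m (∨-true-l _ (∧-true-intro e (eqb-refl _))))))
    walk (inj₂ m ◅ c) e = walk c (reach-closed es v _
      (∨-true-r (reachIn es v n _) (anyL-intro _ m (∨-true-r (reachIn es v n _ ∧ _) (∧-true-intro e (eqb-refl _))))))

  connected? : ∀ {n} (L : EdgeList n) a b → Dec (Connected L a b)
  connected? L a b with Vec.lookup (reach L a) b in e
  ... | true  = yes (reach-sound L a b e)
  ... | false = no (λ c → true≢false (trans (sym (reach-complete L a b c)) e))

  -- Component representatives: isRep (Defs) picks the least vertex of each component,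
  -- so kSpan counts components.

  IsRep : ∀ {n} → EdgeList n → Fin n → Set
  IsRep L x = ∀ y → Connected L x y → toℕ x ≤ toℕ y

  ≤ᵇ-true : ∀ {m n} → ⌊ m ≤? n ⌋ ≡ true → m ≤ n
  ≤ᵇ-true {m} {n} e with m ≤? n
  ... | yes p = p

  ≤ᵇ-intro : ∀ {m n} → m ≤ n → ⌊ m ≤? n ⌋ ≡ true
  ≤ᵇ-intro {m} {n} p with m ≤? n
  ... | yes _ = refl
  ... | no np = ⊥-elim (np p)

  isRep⇒ : ∀ {n} (L : EdgeList n) x → isRep L x ≡ true → IsRep L x
  isRep⇒ L x e y c with ∨-true-split {not (Vec.lookup (reach L x) y)} (allV-true _ e y)
  ... | inj₁ nr = ⊥-elim (true≢false (trans (sym (reach-complete L x y c)) (not-true nr)))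
  ... | inj₂ le = ≤ᵇ-true le

  isRep⇐ : ∀ {n} (L : EdgeList n) x → IsRep L x → isRep L x ≡ true
  isRep⇐ L x h = allV-intro _ (λ y → test y (Vec.lookup (reach L x) y) refl)
    where
    test : ∀ y b → Vec.lookup (reach L x) y ≡ b → not b ∨ ⌊ toℕ x ≤? toℕ y ⌋ ≡ true
    test y false e = refl
    test y true  e = ≤ᵇ-intro (h y (reach-sound L x y e))

  findMin : ∀ {n} (p : Fin n → Bool) v → p v ≡ true →
    Σ (Fin n) λ r → (p r ≡ true) × (∀ u → p u ≡ true → toℕ r ≤ toℕ u)
  findMin {suc n} p v pv with p zero in e0
  ... | true = zero , e0 , (λ u _ → z≤n)
  findMin {suc n} p zero    pv | false = ⊥-elim (true≢false (trans (sym pv) e0))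
  findMin {suc n} p (suc v) pv | false with findMin (λ x → p (suc x)) v pv
  ... | r , pr , least = suc r , pr , least'
    where
    least' : ∀ u → p u ≡ true → suc (toℕ r) ≤ toℕ u
    least' zero    pu = ⊥-elim (true≢false (trans (sym pu) e0))
    least' (suc u) pu = s≤s (least u pu)

  rep : ∀ {n} (L : EdgeList n) a → Σ (Fin n) λ r → Connected L a r × IsRep L r
  rep L a with findMin (λ u → Vec.lookup (reach L a) u) a (reach-complete L a a ε)
  ... | r , pr , least = r , reach-sound L a r pr ,
    (λ y c → least y (reach-complete L a y (reach-sound L a r pr ◅◅ c)))

  rep-unique : ∀ {n} {L : EdgeList n} {r s} → IsRep L r → IsRep L s → Connected L r s → r ≡ s
  rep-unique {r = r} {s} hr hs c = toℕ-injective (ℕP.≤-antisym (hr s c) (hs r (conn-sym c)))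

  isRep-same : ∀ {n} {L L' : EdgeList n} → Sub L L' → Sub L' L → ∀ x → isRep L x ≡ isRep L' x
  isRep-same s s' x = bool-ext (λ e → isRep⇐ _ x (λ y c → isRep⇒ _ x e y (conn-sub s' c)))
                               (λ e → isRep⇐ _ x (λ y c → isRep⇒ _ x e y (conn-sub s c)))

  kSpan-same : ∀ {n} {L L' : EdgeList n} → Sub L L' → Sub L' L → kSpan L ≡ kSpan L'
  kSpan-same s s' = countV-cong (isRep-same s s')

  kSpan-[] : ∀ n → kSpan {n} [] ≡ n
  kSpan-[] n = countV-true _ (λ x → isRep⇐ [] x λ { y ε → ℕP.≤-refl ; y (inj₁ () ◅ _) ; y (inj₂ () ◅ _) })

  module AddEdge {n} (L : EdgeList n) (a b : Fin n) where
    L' : EdgeList n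
    L' = (a , b) ∷ L

    InAB : Fin n → Set
    InAB z = Connected L z a ⊎ Connected L z b

    weaken : ∀ {x y} → Connected L x y → Connected L' x y
    weaken = conn-sub there

    inAB→a : ∀ {z} → InAB z → Connected L' z a
    inAB→a (inj₁ c) = weaken c
    inAB→a (inj₂ c) = weaken c ◅◅ (inj₂ (here refl) ◅ ε)

    inAB-conn : ∀ {x y} → InAB x → InAB y → Connected L' x y
    inAB-conn ix iy = inAB→a ix ◅◅ conn-sym (inAB→a iy)

    inAB-back : ∀ {x y} → Connected L x y → InAB y → InAB x
    inAB-back c (inj₁ d) = inj₁ (c ◅◅ d)
    inAB-back c (inj₂ d) = inj₂ (c ◅◅ d)

    walk-cases : ∀ {x y} → Connected L' x y → Connected L x y ⊎ (InAB x × InAB y)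
    walk-cases ε = inj₁ ε
    walk-cases (s ◅ p) with walk-cases p
    walk-cases (inj₁ (here refl) ◅ p) | inj₁ c = inj₂ (inj₁ ε , inj₂ (conn-sym c))
    walk-cases (inj₂ (here refl) ◅ p) | inj₁ c = inj₂ (inj₂ ε , inj₁ (conn-sym c))
    walk-cases (inj₁ (there m) ◅ p) | inj₁ c = inj₁ (inj₁ m ◅ c)
    walk-cases (inj₂ (there m) ◅ p) | inj₁ c = inj₁ (inj₂ m ◅ c)
    walk-cases (inj₁ (here refl) ◅ p) | inj₂ (_ , iy) = inj₂ (inj₁ ε , iy)
    walk-cases (inj₂ (here refl) ◅ p) | inj₂ (_ , iy) = inj₂ (inj₂ ε , iy)
    walk-cases (inj₁ (there m) ◅ p) | inj₂ (ix , iy) = inj₂ (inAB-back (inj₁ m ◅ ε) ix , iy)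
    walk-cases (inj₂ (there m) ◅ p) | inj₂ (ix , iy) = inj₂ (inAB-back (inj₂ m ◅ ε) ix , iy)

    kSpan-connected : Connected L a b → kSpan L' ≡ kSpan L
    kSpan-connected ab = countV-cong λ x → bool-ext
      (λ e → isRep⇐ L x (λ y c → isRep⇒ L' x e y (weaken c)))
      (λ e → isRep⇐ L' x (λ y c → isRep⇒ L x e y (unweaken c)))
      where
      toA : ∀ {z} → InAB z → Connected L z a
      toA (inj₁ c) = c
      toA (inj₂ c) = c ◅◅ conn-sym ab
      unweaken : ∀ {x y} → Connected L' x y → Connected L x y
      unweaken c with walk-cases c
      ... | inj₁ d = d
      ... | inj₂ (ix , iy) = toA ix ◅◅ conn-sym (toA iy)

    -- In the disconnected case the representatives of L' are those of L except the
    -- larger of the representatives ra, rb of a and b.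
    module Disconnected (nab : ¬ Connected L a b) where
      ra = proj₁ (rep L a)
      rb = proj₁ (rep L b)
      Ca : Connected L a ra
      Ca = proj₁ (proj₂ (rep L a))
      Cb : Connected L b rb
      Cb = proj₁ (proj₂ (rep L b))
      Ra : IsRep L ra
      Ra = proj₂ (proj₂ (rep L a))
      Rb : IsRep L rb
      Rb = proj₂ (proj₂ (rep L b))

      record Ordered : Set where
        field
          r s : Fin n
          rs  : (r ≡ ra × s ≡ rb) ⊎ (r ≡ rb × s ≡ ra)
          s≤r : toℕ s ≤ toℕ r

      ordered : Ordered
      ordered with toℕ ra ≤? toℕ rb
      ... | yes le = record { r = rb ; s = ra ; rs = inj₂ (refl , refl) ; s≤r = le }
      ... | no nle = record { r = ra ; s = rb ; rs = inj₁ (refl , refl) ; s≤r = ℕP.<⇒≤ (ℕP.≰⇒> nle) }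

      open Ordered ordered

      ra≢rb : ra ≢ rb
      ra≢rb e = nab (Ca ◅◅ subst (Connected L ra) e ε ◅◅ conn-sym Cb)

      r≢s : r ≢ s
      r≢s e with rs
      ... | inj₁ (p , q) = ra≢rb (trans (sym p) (trans e q))
      ... | inj₂ (p , q) = ra≢rb (sym (trans (sym p) (trans e q)))

      inAB-r : InAB r
      inAB-r with rs
      ... | inj₁ (p , _) = inj₁ (subst (λ z → Connected L z a) (sym p) (conn-sym Ca))
      ... | inj₂ (p , _) = inj₂ (subst (λ z → Connected L z b) (sym p) (conn-sym Cb))

      inAB-s : InAB s
      inAB-s with rs
      ... | inj₁ (_ , q) = inj₂ (subst (λ z → Connected L z b) (sym q) (conn-sym Cb))
      ... | inj₂ (_ , q) = inj₁ (subst (λ z → Connected L z a) (sym q) (conn-sym Ca))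

      Rr : IsRep L r
      Rr with rs
      ... | inj₁ (p , _) = subst (IsRep L) (sym p) Ra
      ... | inj₂ (p , _) = subst (IsRep L) (sym p) Rb

      s≤ra : toℕ s ≤ toℕ ra
      s≤ra with rs
      ... | inj₁ (p , _) = subst (λ z → toℕ s ≤ toℕ z) p s≤r
      ... | inj₂ (_ , q) = subst (λ z → toℕ s ≤ toℕ z) q ℕP.≤-refl

      s≤rb : toℕ s ≤ toℕ rb
      s≤rb with rs
      ... | inj₁ (_ , q) = subst (λ z → toℕ s ≤ toℕ z) q ℕP.≤-refl
      ... | inj₂ (p , _) = subst (λ z → toℕ s ≤ toℕ z) p s≤r

      s-least : ∀ {y} → InAB y → toℕ s ≤ toℕ y
      s-least (inj₁ c) = ℕP.≤-trans s≤ra (Ra _ (conn-sym Ca ◅◅ conn-sym c))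
      s-least (inj₂ c) = ℕP.≤-trans s≤rb (Rb _ (conn-sym Cb ◅◅ conn-sym c))

      rep-in-AB : ∀ {x} → IsRep L x → InAB x → x ≢ r → x ≡ s
      rep-in-AB h (inj₁ c) ne with rs
      ... | inj₁ (p , q) = ⊥-elim (ne (trans (rep-unique h Ra (c ◅◅ Ca)) (sym p)))
      ... | inj₂ (p , q) = trans (rep-unique h Ra (c ◅◅ Ca)) (sym q)
      rep-in-AB h (inj₂ c) ne with rs
      ... | inj₁ (p , q) = trans (rep-unique h Rb (c ◅◅ Cb)) (sym q)
      ... | inj₂ (p , q) = ⊥-elim (ne (trans (rep-unique h Rb (c ◅◅ Cb)) (sym p)))

      isRep-L' : ∀ x → isRep L' x ≡ isRep L x ∧ not (eqb x r)
      isRep-L' x = bool-ext forward backward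
        where
        forward : isRep L' x ≡ true → isRep L x ∧ not (eqb x r) ≡ true
        forward e = ∧-true-intro (isRep⇐ L x (λ y c → h y (weaken c))) (x≢r (x ≟ r))
          where
          h = isRep⇒ L' x e
          x≢r : (d : Dec (x ≡ r)) → not ⌊ d ⌋ ≡ true
          x≢r (yes refl) = ⊥-elim (r≢s (toℕ-injective (ℕP.≤-antisym (h s (inAB-conn inAB-r inAB-s)) s≤r)))
          x≢r (no _) = refl
        backward : isRep L x ∧ not (eqb x r) ≡ true → isRep L' x ≡ true
        backward e with ∧-true-split {isRep L x} e
        ... | e1 , e2 = isRep⇐ L' x least
          where
          hx = isRep⇒ L x e1
          ne : x ≢ r
          ne refl = true≢false (trans (sym e2) (cong not (eqb-refl x)))
          least : IsRep L' x
          least y c with walk-cases c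
          ... | inj₁ d = hx y d
          ... | inj₂ (ix , iy) = subst (λ z → toℕ z ≤ toℕ y) (sym (rep-in-AB hx ix ne)) (s-least iy)

      kSpan-disconnected : kSpan L ≡ suc (kSpan L')
      kSpan-disconnected = trans (countV-point r (isRep L))
        (cong₂ _+_ (cong bit (isRep⇐ L r Rr)) (sym (countV-cong isRep-L')))

  kSpan-conn : ∀ {n} (L : EdgeList n) a b → Connected L a b → kSpan ((a , b) ∷ L) ≡ kSpan L
  kSpan-conn L a b = AddEdge.kSpan-connected L a b

  kSpan-nconn : ∀ {n} (L : EdgeList n) a b → ¬ Connected L a b → kSpan L ≡ suc (kSpan ((a , b) ∷ L))
  kSpan-nconn L a b nab = AddEdge.Disconnected.kSpan-disconnected L a b nab

  -- Covered vertices.  covB L w says that w is an endpoint of some edge of L; uncov L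
  -- counts the vertices that are not, so that kCov L + uncov L = kSpan L.

  covB : ∀ {n} → EdgeList n → Fin n → Bool
  covB L w = anyL (λ p → eqb w (proj₁ p) ∨ eqb w (proj₂ p)) L

  covered-lookup : ∀ {n} (L : EdgeList n) w → Vec.lookup (covered L) w ≡ covB L w
  covered-lookup L w = lookup∘tabulate _ w

  Touch : ∀ {n} → Fin n → Fin n × Fin n → Set
  Touch w p = (w ≡ proj₁ p) ⊎ (w ≡ proj₂ p)

  covB⇒ : ∀ {n} (L : EdgeList n) w → covB L w ≡ true → ∃[ p ] (p ∈ L × Touch w p)
  covB⇒ L w e with anyL-true _ L e
  ... | p , m , t with ∨-true-split {eqb w (proj₁ p)} t
  ... | inj₁ t1 = p , m , inj₁ (eqb-true t1)
  ... | inj₂ t2 = p , m , inj₂ (eqb-true t2)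

  covB⇐ : ∀ {n} (L : EdgeList n) w {p} → p ∈ L → Touch w p → covB L w ≡ true
  covB⇐ L w m (inj₁ refl) = anyL-intro _ m (∨-true-l _ (eqb-refl w))
  covB⇐ L w {p} m (inj₂ refl) = anyL-intro _ m (∨-true-r (eqb w (proj₁ p)) (eqb-refl w))

  covB-++ : ∀ {n} (X Y : EdgeList n) w → covB (X ++ Y) w ≡ covB X w ∨ covB Y w
  covB-++ [] Y w = refl
  covB-++ (p ∷ X) Y w rewrite covB-++ X Y w = sym (∨-assoc (eqb w (proj₁ p) ∨ eqb w (proj₂ p)) (covB X w) (covB Y w))

  ∨-false : ∀ {a b} → a ∨ b ≡ false → (a ≡ false) × (b ≡ false)
  ∨-false {false} {false} _ = refl , refl

  avoid-cons : ∀ {n} {a b w : Fin n} {X : EdgeList n} → covB ((a , b) ∷ X) w ≡ false →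
    (w ≢ a) × (w ≢ b) × (covB X w ≡ false)
  avoid-cons {a = a} {b} {w} {X} e with ∨-false {eqb w a ∨ eqb w b} e
  ... | e1 , e2 with ∨-false {eqb w a} e1
  ... | f1 , f2 = eqb-false f1 , eqb-false f2 , e2

  conn-covered : ∀ {n} {L : EdgeList n} {a b} → a ≢ b → Connected L a b → covB L a ≡ true
  conn-covered ne ε = ⊥-elim (ne refl)
  conn-covered {L = L} {a} ne (inj₁ m ◅ c) = covB⇐ L a m (inj₁ refl)
  conn-covered {L = L} {a} ne (inj₂ m ◅ c) = covB⇐ L a m (inj₂ refl)

  uncov : ∀ {n} → EdgeList n → ℕ
  uncov L = countV (λ v → not (covB L v))

  uncov-[] : ∀ n → uncov {n} [] ≡ n
  uncov-[] n = countV-true _ (λ _ → refl)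

  uncov-isRep : ∀ {n} (L : EdgeList n) v → covB L v ≡ false → isRep L v ≡ true
  uncov-isRep L v nc = isRep⇐ L v isolated
    where
    isolated : IsRep L v
    isolated y ε = ℕP.≤-refl
    isolated y (inj₁ m ◅ c) = ⊥-elim (true≢false (trans (sym (covB⇐ L v m (inj₁ refl))) nc))
    isolated y (inj₂ m ◅ c) = ⊥-elim (true≢false (trans (sym (covB⇐ L v m (inj₂ refl))) nc))

  kCov+uncov : ∀ {n} (L : EdgeList n) → kCov L + uncov L ≡ kSpan L
  kCov+uncov L = sym (trans (countV-split (isRep L) (covB L))
    (cong₂ _+_ (countV-cong (λ x → trans (∧-comm (isRep L x) (covB L x)) (cong (_∧ isRep L x) (sym (covered-lookup L x)))))
               (countV-cong λ x → uncovered x (covB L x) refl)))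
    where
    uncovered : ∀ x b → covB L x ≡ b → isRep L x ∧ not b ≡ not (covB L x)
    uncovered x true  e = trans (∧-zeroʳ _) (cong not (sym e))
    uncovered x false e = trans (cong (_∧ true) (uncov-isRep L x e)) (cong not (sym e))

  -- Effect of a new edge (a , b) on uncov: a and then b (if different) may become covered.
  uncov-cons : ∀ {n} (a b : Fin n) (L : EdgeList n) →
    uncov L ≡ bit (not (covB L a)) + (bit (not (covB L b) ∧ not (eqb b a)) + uncov ((a , b) ∷ L))
  uncov-cons a b L =
    trans (countV-point a f) (cong (bit (f a) +_)
      (trans (countV-point b (λ x → f x ∧ not (eqb x a)))
        (cong (bit (f b ∧ not (eqb b a)) +_) (countV-cong λ x → deMorgan (eqb x a) (eqb x b) (covB L x)))))
    where
    f = λ x → not (covB L x)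
    deMorgan : ∀ p q c → (not c ∧ not p) ∧ not q ≡ not ((p ∨ q) ∨ c)
    deMorgan true  q     c     = cong (_∧ not q) (∧-zeroʳ _)
    deMorgan false true  c     = ∧-zeroʳ _
    deMorgan false false true  = refl
    deMorgan false false false = refl

  bound-step : ∀ K d F U l → K + d ≤ F + U + l → F ≤ 1 + d → K ≤ U + suc l
  bound-step K d F U l h f = ℕP.+-cancelʳ-≤ d K (U + suc l) (ℕP.≤-trans h (ℕP.≤-trans
    (ℕP.+-monoˡ-≤ l (ℕP.+-monoˡ-≤ U f)) (ℕP.≤-reflexive (rearrange d U l))))
    where
    open import Data.Nat.Tactic.RingSolver
    rearrange : ∀ d U l → 1 + d + U + l ≡ U + suc l + d
    rearrange = solve-∀

  -- Each edge lowers the number of components by at most one while covering at most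
  -- two new vertices; hence kSpan L ≤ uncov L + |L|, and so kCov L ≤ |L|.
  kSpan≤ : ∀ {n} (L : EdgeList n) → kSpan L ≤ uncov L + length L
  kSpan≤ {n} [] rewrite kSpan-[] n | uncov-[] n | ℕP.+-identityʳ n = ℕP.≤-refl
  kSpan≤ {n} ((a , b) ∷ L) with connected? L a b
  ... | yes c = bound-step (kSpan L') 0 (fa + fb) (uncov L') (length L)
                  (subst₂ _≤_ (trans (sym (kSpan-conn L a b c)) (sym (ℕP.+-identityʳ _))) uncov-L (kSpan≤ L))
                  newly-covered≤1
    where
    L' = (a , b) ∷ L
    fa = bit (not (covB L a))
    fb = bit (not (covB L b) ∧ not (eqb b a))
    uncov-L = cong (_+ length L) (trans (uncov-cons a b L) (sym (ℕP.+-assoc fa fb _)))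
    -- a loop covers at most a; a proper edge inside a component covers at most b
    newly-covered≤1 : fa + fb ≤ 1
    newly-covered≤1 with a ≟ b
    ... | yes refl rewrite eqb-refl a | ∧-zeroʳ (not (covB L a)) | ℕP.+-identityʳ fa = bit≤1 _
    ... | no ne rewrite conn-covered ne c = bit≤1 _
  ... | no nc = bound-step (kSpan L') 1 (fa + fb) (uncov L') (length L)
                  (subst₂ _≤_ (trans (kSpan-nconn L a b nc) (sym (ℕP.+-comm (kSpan L') 1))) uncov-L (kSpan≤ L))
                  (ℕP.+-mono-≤ (bit≤1 (not (covB L a))) (bit≤1 (not (covB L b) ∧ not (eqb b a))))
    where
    L' = (a , b) ∷ L
    fa = bit (not (covB L a))
    fb = bit (not (covB L b) ∧ not (eqb b a))
    uncov-L = cong (_+ length L) (trans (uncov-cons a b L) (sym (ℕP.+-assoc fa fb _)))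

  kCov≤length : ∀ {n} (L : EdgeList n) → kCov L ≤ length L
  kCov≤length L = ℕP.+-cancelʳ-≤ (uncov L) (kCov L) (length L)
    (subst₂ _≤_ (sym (kCov+uncov L)) (ℕP.+-comm (uncov L) (length L)) (kSpan≤ L))

  djB : ∀ {n} → EdgeList n → EdgeList n → Bool
  djB X Y = disjointV (covered X) (covered Y)

  Disjoint : ∀ {n} → EdgeList n → EdgeList n → Set
  Disjoint X Y = ∀ x → covB X x ≡ true → covB Y x ≡ true → ⊥

  not-∧-true : ∀ {a b} → not (a ∧ b) ≡ true → a ≡ true → b ≡ true → ⊥
  not-∧-true {true} {true} () _ _

  not-∧-intro : ∀ a b → (a ≡ true → b ≡ true → ⊥) → not (a ∧ b) ≡ true
  not-∧-intro true  true  f = ⊥-elim (f refl refl)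
  not-∧-intro true  false f = refl
  not-∧-intro false b     f = refl

  not-true⇒ : ∀ {b} → not b ≡ true → b ≡ true → ⊥
  not-true⇒ {true} () _

  not-intro : ∀ b → (b ≡ true → ⊥) → not b ≡ true
  not-intro true  f = ⊥-elim (f refl)
  not-intro false f = refl

  ∧3-split : ∀ {a b c} → a ∧ b ∧ c ≡ true → (a ≡ true) × (b ≡ true) × (c ≡ true)
  ∧3-split {true} {true} {true} _ = refl , refl , refl

  ∧3-intro : ∀ {a b c} → a ≡ true → b ≡ true → c ≡ true → a ∧ b ∧ c ≡ true
  ∧3-intro refl refl refl = refl

  djB⇒ : ∀ {n} (X Y : EdgeList n) → djB X Y ≡ true → Disjoint X Y
  djB⇒ X Y d x cx cy = not-∧-true (allV-true _ d x)
    (trans (covered-lookup X x) cx) (trans (covered-lookup Y x) cy)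

  djB⇐ : ∀ {n} (X Y : EdgeList n) → Disjoint X Y → djB X Y ≡ true
  djB⇐ X Y h = allV-intro _ λ x → not-∧-intro _ _ λ a b →
    h x (trans (sym (covered-lookup X x)) a) (trans (sym (covered-lookup Y x)) b)

  djB-sym : ∀ {n} (X Y : EdgeList n) → djB X Y ≡ djB Y X
  djB-sym X Y = bool-ext (λ d → djB⇐ Y X (λ x a b → djB⇒ X Y d x b a))
                         (λ d → djB⇐ X Y (λ x a b → djB⇒ Y X d x b a))

  djB-consL : ∀ {n} (a b : Fin n) (X Y : EdgeList n) →
    djB ((a , b) ∷ X) Y ≡ djB X Y ∧ not (covB Y a) ∧ not (covB Y b)
  djB-consL a b X Y = bool-ext forward backward
    where
    forward : djB ((a , b) ∷ X) Y ≡ true → djB X Y ∧ not (covB Y a) ∧ not (covB Y b) ≡ true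
    forward d = ∧3-intro (djB⇐ X Y (λ x cx cy → h x (∨-true-r _ cx) cy))
                         (not-intro _ (h a (∨-true-l _ (∨-true-l _ (eqb-refl a)))))
                         (not-intro _ (h b (∨-true-l _ (∨-true-r (eqb b a) (eqb-refl b)))))
      where h = djB⇒ ((a , b) ∷ X) Y d
    backward : djB X Y ∧ not (covB Y a) ∧ not (covB Y b) ≡ true → djB ((a , b) ∷ X) Y ≡ true
    backward t with ∧3-split {djB X Y} t
    ... | d , na , nb = djB⇐ ((a , b) ∷ X) Y disjoint
      where
      disjoint : Disjoint ((a , b) ∷ X) Y
      disjoint x cx cy with ∨-true-split {eqb x a ∨ eqb x b} cx
      ... | inj₂ c = djB⇒ X Y d x c cy
      ... | inj₁ c with ∨-true-split {eqb x a} c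
      ... | inj₁ q rewrite eqb-true {a = x} q = not-true⇒ na cy
      ... | inj₂ q rewrite eqb-true {a = x} q = not-true⇒ nb cy

  djB-consR : ∀ {n} (a b : Fin n) (X Y : EdgeList n) →
    djB X ((a , b) ∷ Y) ≡ djB X Y ∧ not (covB X a) ∧ not (covB X b)
  djB-consR a b X Y = trans (djB-sym X ((a , b) ∷ Y))
    (trans (djB-consL a b Y X) (cong (λ z → z ∧ not (covB X a) ∧ not (covB X b)) (djB-sym Y X)))

  swap-sub : ∀ {n} (e f : Fin n × Fin n) (L : EdgeList n) → Sub (e ∷ f ∷ L) (f ∷ e ∷ L)
  swap-sub e f L (here p)          = there (here p)
  swap-sub e f L (there (here p))  = here p
  swap-sub e f L (there (there m)) = there (there m)

  module Merge {k} (u v : Fin (suc k)) (u≢v : u ≢ v) where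
    merge : Fin (suc k) → Fin k
    merge = mergeV u v u≢v

    mergeEdge : Fin (suc k) × Fin (suc k) → Fin k × Fin k
    mergeEdge p = merge (proj₁ p) , merge (proj₂ p)

    mergeAll : EdgeList (suc k) → EdgeList k
    mergeAll = map mergeEdge

    e : Fin (suc k) × Fin (suc k)
    e = (u , v)

    v≢u : v ≢ u
    v≢u q = u≢v (sym q)

    w : Fin k
    w = punchOut {i = v} {j = u} v≢u

    merge-other : ∀ x (h : v ≢ x) → merge x ≡ punchOut h
    merge-other x h with v ≟ x
    ... | yes q = ⊥-elim (h q)
    ... | no h' = punchOut-cong v refl

    merge-v : merge v ≡ w
    merge-v with v ≟ v
    ... | yes _ = refl
    ... | no h  = ⊥-elim (h refl)

    merge-u : merge u ≡ w
    merge-u = trans (merge-other u v≢u) (punchOut-cong v refl)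

    merge-punchIn : ∀ y → merge (punchIn v y) ≡ y
    merge-punchIn y = trans (merge-other _ (λ q → punchInᵢ≢i v y (sym q))) (trans (punchOut-cong v refl) (punchOut-punchIn v))

    punchIn-w : punchIn v w ≡ u
    punchIn-w = punchIn-punchOut v≢u

    InUV : Fin (suc k) → Set
    InUV z = (z ≡ u) ⊎ (z ≡ v)

    fiber : ∀ x y → merge x ≡ merge y → (x ≡ y) ⊎ (InUV x × InUV y)
    fiber x y q = cases (v ≟ x) (v ≟ y)
      where
      cases : Dec (v ≡ x) → Dec (v ≡ y) → (x ≡ y) ⊎ (InUV x × InUV y)
      cases (yes refl) (yes refl) = inj₁ refl
      cases (yes refl) (no hy) =
        inj₂ (inj₂ refl , inj₁ (sym (punchOut-injective v≢u hy (trans (sym merge-v) (trans q (merge-other y hy))))))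
      cases (no hx) (yes refl) =
        inj₂ (inj₁ (punchOut-injective hx v≢u (trans (sym (merge-other x hx)) (trans q merge-v))) , inj₂ refl)
      cases (no hx) (no hy) = inj₁ (punchOut-injective hx hy (trans (sym (merge-other x hx)) (trans q (merge-other y hy))))

    merge-uv : ∀ {x} → InUV x → merge x ≡ w
    merge-uv (inj₁ refl) = merge-u
    merge-uv (inj₂ refl) = merge-v

    module _ (X : EdgeList (suc k)) where
      uv-conn : ∀ {x y} → InUV x → InUV y → Connected (e ∷ X) x y
      uv-conn (inj₁ refl) (inj₁ refl) = ε
      uv-conn (inj₁ refl) (inj₂ refl) = inj₁ (here refl) ◅ ε
      uv-conn (inj₂ refl) (inj₁ refl) = inj₂ (here refl) ◅ ε
      uv-conn (inj₂ refl) (inj₂ refl) = ε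

      fiber-conn : ∀ x y → merge x ≡ merge y → Connected (e ∷ X) x y
      fiber-conn x y q with fiber x y q
      ... | inj₁ refl = ε
      ... | inj₂ (ix , iy) = uv-conn ix iy

      merge-walk : ∀ {a b} → Connected (e ∷ X) a b → Connected (mergeAll X) (merge a) (merge b)
      merge-walk ε = ε
      merge-walk {b = b} (inj₁ (here refl) ◅ c) = subst (λ z → Connected (mergeAll X) z (merge b)) (trans merge-v (sym merge-u)) (merge-walk c)
      merge-walk {b = b} (inj₂ (here refl) ◅ c) = subst (λ z → Connected (mergeAll X) z (merge b)) (trans merge-u (sym merge-v)) (merge-walk c)
      merge-walk (inj₁ (there q) ◅ c) = inj₁ (∈-map⁺ mergeEdge q) ◅ merge-walk c
      merge-walk (inj₂ (there q) ◅ c) = inj₂ (∈-map⁺ mergeEdge q) ◅ merge-walk c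

      unmerge-walk : ∀ {a' b'} → Connected (mergeAll X) a' b' → ∀ a b → merge a ≡ a' → merge b ≡ b' → Connected (e ∷ X) a b
      unmerge-walk ε a b qa qb = fiber-conn a b (trans qa (sym qb))
      unmerge-walk (inj₁ mem ◅ c) a b qa qb with ∈-map⁻ mergeEdge mem
      ... | (p , q) , pq∈ , eq = fiber-conn a p (trans qa (cong proj₁ eq))
                                 ◅◅ inj₁ (there pq∈) ◅ unmerge-walk c q b (sym (cong proj₂ eq)) qb
      unmerge-walk (inj₂ mem ◅ c) a b qa qb with ∈-map⁻ mergeEdge mem
      ... | (p , q) , pq∈ , eq = fiber-conn a q (trans qa (cong proj₂ eq))
                                 ◅◅ inj₂ (there pq∈) ◅ unmerge-walk c p b (sym (cong proj₁ eq)) qb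

    kSpan-merge : ∀ X → kSpan (e ∷ X) ≡ kSpan (mergeAll X)
    kSpan-merge [] = ℕP.suc-injective (trans (sym (kSpan-nconn [] u v (λ c → u≢v (no-walk c))))
                                            (trans (kSpan-[] (suc k)) (cong suc (sym (kSpan-[] k)))))
      where
      no-walk : Connected [] u v → u ≡ v
      no-walk ε = refl
      no-walk (inj₁ () ◅ _)
      no-walk (inj₂ () ◅ _)
    kSpan-merge ((a , b) ∷ X) with connected? (e ∷ X) a b
    ... | yes c = trans (kSpan-same (swap-sub e (a , b) X) (swap-sub (a , b) e X))
                  (trans (kSpan-conn (e ∷ X) a b c)
                  (trans (kSpan-merge X) (sym (kSpan-conn (mergeAll X) (merge a) (merge b) (merge-walk X c)))))
    ... | no nc = trans (kSpan-same (swap-sub e (a , b) X) (swap-sub (a , b) e X))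
                  (ℕP.suc-injective (trans (sym (kSpan-nconn (e ∷ X) a b nc))
                    (trans (kSpan-merge X) (kSpan-nconn (mergeAll X) (merge a) (merge b)
                                             (λ c → nc (unmerge-walk X c a b refl refl))))))

    covB-merge⁺ : ∀ X x → covB X x ≡ true → covB (mergeAll X) (merge x) ≡ true
    covB-merge⁺ X x c with covB⇒ X x c
    ... | p , mem , inj₁ refl = covB⇐ (mergeAll X) _ (∈-map⁺ mergeEdge mem) (inj₁ refl)
    ... | p , mem , inj₂ refl = covB⇐ (mergeAll X) _ (∈-map⁺ mergeEdge mem) (inj₂ refl)

    covB-merge⁻ : ∀ X y → covB (mergeAll X) y ≡ true → ∃[ x ] (merge x ≡ y × covB X x ≡ true)
    covB-merge⁻ X y c with covB⇒ (mergeAll X) y c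
    ... | p' , mem , t with ∈-map⁻ mergeEdge mem
    ... | (p , q) , pq∈ , refl with t
    ... | inj₁ refl = p , refl , covB⇐ X p pq∈ (inj₁ refl)
    ... | inj₂ refl = q , refl , covB⇐ X q pq∈ (inj₂ refl)

    covB-merge-other : ∀ X y → y ≢ w → covB (mergeAll X) y ≡ covB X (punchIn v y)
    covB-merge-other X y ny = bool-ext forward backward
      where
      forward : covB (mergeAll X) y ≡ true → covB X (punchIn v y) ≡ true
      forward c with covB-merge⁻ X y c
      ... | x , mx , cx with fiber x (punchIn v y) (trans mx (sym (merge-punchIn y)))
      ... | inj₁ refl = cx
      ... | inj₂ (ix , _) = ⊥-elim (ny (trans (sym mx) (merge-uv ix)))
      backward : covB X (punchIn v y) ≡ true → covB (mergeAll X) y ≡ true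
      backward c = subst (λ z → covB (mergeAll X) z ≡ true) (merge-punchIn y) (covB-merge⁺ X _ c)

    covB-merge-w : ∀ X → covB (mergeAll X) w ≡ covB X u ∨ covB X v
    covB-merge-w X = bool-ext forward backward
      where
      forward : covB (mergeAll X) w ≡ true → covB X u ∨ covB X v ≡ true
      forward c with covB-merge⁻ X w c
      ... | x , mx , cx with fiber x u (trans mx (sym merge-u))
      ... | inj₁ refl = ∨-true-l _ cx
      ... | inj₂ (inj₁ refl , _) = ∨-true-l _ cx
      ... | inj₂ (inj₂ refl , _) = ∨-true-r (covB X u) cx
      backward : covB X u ∨ covB X v ≡ true → covB (mergeAll X) w ≡ true
      backward c with ∨-true-split {covB X u} c
      ... | inj₁ cu = subst (λ z → covB (mergeAll X) z ≡ true) merge-u (covB-merge⁺ X u cu)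
      ... | inj₂ cv = subst (λ z → covB (mergeAll X) z ≡ true) merge-v (covB-merge⁺ X v cv)

    punchIn≢u : ∀ y → y ≢ w → punchIn v y ≢ u
    punchIn≢u y ny q = ny (trans (sym (merge-punchIn y)) (trans (cong merge q) merge-u))

    uncov-merge : ∀ X → uncov (e ∷ X) + bit (not (covB X u) ∧ not (covB X v)) ≡ uncov (mergeAll X)
    uncov-merge X = begin
      uncov (e ∷ X) + B                                                 ≡⟨ cong (_+ B) (countV-punchIn v f) ⟩
      (bit (not (covB (e ∷ X) v)) + countV g) + B                        ≡⟨ cong (λ b → (bit (not b) + countV g) + B) fv ⟩
      countV g + B                                                      ≡⟨ cong (_+ B) (countV-point w g) ⟩
      (bit (g w) + countV (λ y → g y ∧ not (eqb y w))) + B               ≡⟨ cong (λ b → (bit (not b) + countV (λ y → g y ∧ not (eqb y w))) + B) fu ⟩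
      countV (λ y → g y ∧ not (eqb y w)) + B                            ≡⟨ ℕP.+-comm _ B ⟩
      B + countV (λ y → g y ∧ not (eqb y w))                            ≡⟨ cong₂ _+_ hw (countV-cong away-from-w) ⟨
      bit (h w) + countV (λ y → h y ∧ not (eqb y w))                     ≡⟨ countV-point w h ⟨
      uncov (mergeAll X)                                                ∎
      where
      open ≡-Reasoning
      B = bit (not (covB X u) ∧ not (covB X v))
      f = λ x → not (covB (e ∷ X) x)
      g = λ y → f (punchIn v y)
      h = λ y → not (covB (mergeAll X) y)
      fv : covB (e ∷ X) v ≡ true
      fv = ∨-true-l _ (∨-true-r (eqb v u) (eqb-refl v))
      fu : covB (e ∷ X) (punchIn v w) ≡ true
      fu rewrite punchIn-w = ∨-true-l _ (∨-true-l _ (eqb-refl u))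
      hw : bit (h w) ≡ B
      hw = trans (cong (λ b → bit (not b)) (covB-merge-w X)) (cong bit (deMorgan (covB X u) (covB X v)))
        where
        deMorgan : ∀ a b → not (a ∨ b) ≡ not a ∧ not b
        deMorgan true  b = refl
        deMorgan false b = refl
      away-from-w : ∀ y → h y ∧ not (eqb y w) ≡ g y ∧ not (eqb y w)
      away-from-w y with y ≟ w
      ... | yes _ = trans (∧-zeroʳ _) (sym (∧-zeroʳ _))
      ... | no ny rewrite covB-merge-other X y ny | eqb-≢ (punchIn≢u y ny) | eqb-≢ (λ q → punchInᵢ≢i v y q) = refl

    kCov-merge-touching : ∀ X → covB X u ∨ covB X v ≡ true → kCov (e ∷ X) ≡ kCov (mergeAll X)
    kCov-merge-touching X t = ℕP.+-cancelʳ-≡ (uncov (e ∷ X)) _ _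
      (trans (kCov+uncov (e ∷ X)) (trans (kSpan-merge X) (trans (sym (kCov+uncov (mergeAll X)))
        (cong (kCov (mergeAll X) +_) (trans (sym (uncov-merge X))
          (trans (cong (λ b → uncov (e ∷ X) + bit b) (touched (covB X u) (covB X v) t)) (ℕP.+-identityʳ _)))))))
      where
      touched : ∀ a b → a ∨ b ≡ true → not a ∧ not b ≡ false
      touched true  b    _ = refl
      touched false true _ = refl

    kSpan-merge-avoiding : ∀ X → covB X v ≡ false → kSpan X ≡ suc (kSpan (mergeAll X))
    kSpan-merge-avoiding X nv =
      trans (kSpan-nconn X u v (λ c → true≢false (trans (sym (conn-covered v≢u (conn-sym c))) nv)))
            (cong suc (kSpan-merge X))

    uncov-merge-avoiding : ∀ X → covB X v ≡ false → uncov X ≡ suc (uncov (mergeAll X))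
    uncov-merge-avoiding X nv = begin
      uncov X                                                                 ≡⟨ uncov-cons u v X ⟩
      bit (not (covB X u)) + (bit (not (covB X v) ∧ not (eqb v u)) + U)        ≡⟨ cong (λ c → bit (not (covB X u)) + (bit (not c ∧ not (eqb v u)) + U)) nv ⟩
      bit (not (covB X u)) + (bit (not (eqb v u)) + U)                         ≡⟨ cong (λ c → bit (not (covB X u)) + (bit (not c) + U)) (eqb-≢ v≢u) ⟩
      bit (not (covB X u)) + suc U                                            ≡⟨ ℕP.+-suc _ U ⟩
      suc (bit (not (covB X u)) + U)                                          ≡⟨ cong suc (ℕP.+-comm _ U) ⟩
      suc (U + bit (not (covB X u)))                                          ≡⟨ cong (λ c → suc (U + bit c)) (sym (trans (cong (λ c → not (covB X u) ∧ not c) nv) (∧-identityʳ _))) ⟩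
      suc (U + bit (not (covB X u) ∧ not (covB X v)))                         ≡⟨ cong suc (uncov-merge X) ⟩
      suc (uncov (mergeAll X))                                                ∎
      where
      open ≡-Reasoning
      U = uncov (e ∷ X)

    -- When v is uncovered, identifying it with u just deletes it: kCov is unchanged.
    kCov-merge-avoiding : ∀ X → covB X v ≡ false → kCov X ≡ kCov (mergeAll X)
    kCov-merge-avoiding X nv = ℕP.suc-injective (ℕP.+-cancelʳ-≡ (uncov (mergeAll X)) _ _
      (trans (sym (ℕP.+-suc (kCov X) _)) (trans (cong (kCov X +_) (sym (uncov-merge-avoiding X nv)))
        (trans (kCov+uncov X) (trans (kSpan-merge-avoiding X nv) (cong suc (sym (kCov+uncov (mergeAll X)))))))))

    djB-merge : ∀ X Y → djB (mergeAll X) (mergeAll Y) ≡ djB X Y ∧ not (covB X u ∧ covB Y v) ∧ not (covB X v ∧ covB Y u)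
    djB-merge X Y = bool-ext forward backward
      where
      forward : djB (mergeAll X) (mergeAll Y) ≡ true → djB X Y ∧ not (covB X u ∧ covB Y v) ∧ not (covB X v ∧ covB Y u) ≡ true
      forward d = ∧3-intro (djB⇐ X Y (λ x cx cy → h (merge x) (covB-merge⁺ X x cx) (covB-merge⁺ Y x cy)))
        (not-∧-intro _ _ (λ a b → h w (at-w X u merge-u a) (at-w Y v merge-v b)))
        (not-∧-intro _ _ (λ a b → h w (at-w X v merge-v a) (at-w Y u merge-u b)))
        where
        h = djB⇒ (mergeAll X) (mergeAll Y) d
        at-w : ∀ Z x → merge x ≡ w → covB Z x ≡ true → covB (mergeAll Z) w ≡ true
        at-w Z x q c = subst (λ z → covB (mergeAll Z) z ≡ true) q (covB-merge⁺ Z x c)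
      backward : djB X Y ∧ not (covB X u ∧ covB Y v) ∧ not (covB X v ∧ covB Y u) ≡ true → djB (mergeAll X) (mergeAll Y) ≡ true
      backward t with ∧3-split {djB X Y} t
      ... | d , n1 , n2 = djB⇐ (mergeAll X) (mergeAll Y) disjoint
        where
        disjoint : Disjoint (mergeAll X) (mergeAll Y)
        disjoint y cx cy with covB-merge⁻ X y cx | covB-merge⁻ Y y cy
        ... | x1 , m1 , c1 | x2 , m2 , c2 with fiber x1 x2 (trans m1 (sym m2))
        ... | inj₁ refl = djB⇒ X Y d x1 c1 c2
        ... | inj₂ (inj₁ refl , inj₁ refl) = djB⇒ X Y d x1 c1 c2
        ... | inj₂ (inj₂ refl , inj₂ refl) = djB⇒ X Y d x1 c1 c2
        ... | inj₂ (inj₁ refl , inj₂ refl) = not-∧-true n1 c1 c2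
        ... | inj₂ (inj₂ refl , inj₁ refl) = not-∧-true n2 c1 c2

  -- Deleting a vertex w that no edge touches (removeVertex of Defs, as used by `dagger`)
  -- is the same as merging it into any other vertex; hence it loses exactly one
  -- component and keeps kCov, lengths and disjointness.

  removeVertex-avoid : ∀ {k} (w : Fin (suc k)) (a b : Fin (suc k)) (X : EdgeList (suc k)) (ha : w ≢ a) (hb : w ≢ b) →
    removeVertex ((a , b) ∷ X) w ≡ (punchOut ha , punchOut hb) ∷ removeVertex X w
  removeVertex-avoid w a b X ha hb with w ≟ a | w ≟ b
  ... | yes q | _     = ⊥-elim (ha q)
  ... | no _  | yes q = ⊥-elim (hb q)
  ... | no _  | no _  = cong₂ (λ x y → (x , y) ∷ removeVertex X w) (punchOut-cong w refl) (punchOut-cong w refl)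

  removeVertex-touch : ∀ {k} (w : Fin (suc k)) (a b : Fin (suc k)) (X : EdgeList (suc k)) → (w ≡ a) ⊎ (w ≡ b) →
    removeVertex ((a , b) ∷ X) w ≡ removeVertex X w
  removeVertex-touch w a b X t with w ≟ a | w ≟ b
  ... | yes _ | _     = refl
  ... | no _  | yes _ = refl
  removeVertex-touch w a b X (inj₁ q) | no h | no _ = ⊥-elim (h q)
  removeVertex-touch w a b X (inj₂ q) | no _ | no h = ⊥-elim (h q)

  removeVertex-++ : ∀ {k} (X Y : EdgeList (suc k)) w → removeVertex (X ++ Y) w ≡ removeVertex X w ++ removeVertex Y w
  removeVertex-++ [] Y w = refl
  removeVertex-++ ((a , b) ∷ X) Y w with w ≟ a | w ≟ b
  ... | no _  | no _  = cong (_ ∷_) (removeVertex-++ X Y w)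
  ... | yes _ | _     = removeVertex-++ X Y w
  ... | no _  | yes _ = removeVertex-++ X Y w

  removeVertex-length≤ : ∀ {k} (X : EdgeList (suc k)) w → length (removeVertex X w) ≤ length X
  removeVertex-length≤ [] w = z≤n
  removeVertex-length≤ ((a , b) ∷ X) w with w ≟ a | w ≟ b
  ... | no _  | no _  = s≤s (removeVertex-length≤ X w)
  ... | yes _ | _     = ℕP.m≤n⇒m≤1+n (removeVertex-length≤ X w)
  ... | no _  | yes _ = ℕP.m≤n⇒m≤1+n (removeVertex-length≤ X w)

  removeVertex-length : ∀ {k} (w : Fin (suc k)) (X : EdgeList (suc k)) → covB X w ≡ false → length (removeVertex X w) ≡ length X
  removeVertex-length w [] e = refl
  removeVertex-length w ((a , b) ∷ X) e with avoid-cons {X = X} e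
  ... | ha , hb , e' rewrite removeVertex-avoid w a b X ha hb = cong suc (removeVertex-length w X e')

  eqb-punchOut : ∀ {k} (w a : Fin (suc k)) (h : w ≢ a) (y : Fin k) → eqb y (punchOut h) ≡ eqb (punchIn w y) a
  eqb-punchOut w a h y = bool-ext
    (λ q → trans (cong (λ z → eqb (punchIn w z) a) (eqb-true q)) (trans (cong (λ z → eqb z a) (punchIn-punchOut h)) (eqb-refl a)))
    (λ q → trans (cong (eqb y) (trans (punchOut-cong w (sym (eqb-true q))) (punchOut-punchIn w))) (eqb-refl y))

  covB-removeVertex : ∀ {k} (w : Fin (suc k)) (X : EdgeList (suc k)) → covB X w ≡ false →
    ∀ y → covB (removeVertex X w) y ≡ covB X (punchIn w y)
  covB-removeVertex w [] e y = refl
  covB-removeVertex w ((a , b) ∷ X) e y with avoid-cons {X = X} e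
  ... | ha , hb , e' rewrite removeVertex-avoid w a b X ha hb | eqb-punchOut w a ha y | eqb-punchOut w b hb y
                           | covB-removeVertex w X e' y = refl

  removeVertex≡mergeAll : ∀ {k} (u' w : Fin (suc k)) (ne : u' ≢ w) X → covB X w ≡ false →
    removeVertex X w ≡ Merge.mergeAll u' w ne X
  removeVertex≡mergeAll u' w ne [] e = refl
  removeVertex≡mergeAll u' w ne ((a , b) ∷ X) e with avoid-cons {X = X} e
  ... | ha , hb , e' rewrite removeVertex-avoid w a b X ha hb =
    cong₂ _∷_ (cong₂ _,_ (sym (Merge.merge-other u' w ne a ha)) (sym (Merge.merge-other u' w ne b hb)))
              (removeVertex≡mergeAll u' w ne X e')

  anotherVertex : ∀ {k} (w : Fin (suc (suc k))) → Σ (Fin (suc (suc k))) λ u' → u' ≢ w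
  anotherVertex zero    = suc zero , λ ()
  anotherVertex (suc w) = zero , λ ()

  avoid-single : ∀ (X : EdgeList 1) → covB X zero ≡ false → X ≡ []
  avoid-single [] e = refl
  avoid-single ((zero , b) ∷ X) e = ⊥-elim (proj₁ (avoid-cons {a = zero} {b} {zero} {X} e) refl)

  kSpan-removeVertex : ∀ {k} (w : Fin (suc k)) (X : EdgeList (suc k)) → covB X w ≡ false →
    kSpan X ≡ suc (kSpan (removeVertex X w))
  kSpan-removeVertex {zero} zero X e with avoid-single X e
  ... | refl = refl
  kSpan-removeVertex {suc k} w X e with anotherVertex w
  ... | u' , ne rewrite removeVertex≡mergeAll u' w ne X e = Merge.kSpan-merge-avoiding u' w ne X e

  kCov-removeVertex : ∀ {k} (w : Fin (suc k)) (X : EdgeList (suc k)) → covB X w ≡ false → kCov X ≡ kCov (removeVertex X w)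
  kCov-removeVertex {zero} zero X e with avoid-single X e
  ... | refl = refl
  kCov-removeVertex {suc k} w X e with anotherVertex w
  ... | u' , ne rewrite removeVertex≡mergeAll u' w ne X e = Merge.kCov-merge-avoiding u' w ne X e

  djB-removeVertex : ∀ {k} (w : Fin (suc k)) (X Y : EdgeList (suc k)) → covB X w ≡ false → covB Y w ≡ false →
    djB X Y ≡ djB (removeVertex X w) (removeVertex Y w)
  djB-removeVertex {zero} zero X Y e f with avoid-single X e | avoid-single Y f
  ... | refl | refl = refl
  djB-removeVertex {suc k} w X Y e f with anotherVertex w
  ... | u' , ne rewrite removeVertex≡mergeAll u' w ne X e | removeVertex≡mergeAll u' w ne Y f
                      | Merge.djB-merge u' w ne X Y | e | f = simplify (djB X Y) (covB X u')
    where
    simplify : ∀ d c → d ≡ d ∧ not (c ∧ false) ∧ true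
    simplify true  true  = refl
    simplify true  false = refl
    simplify false c     = refl

  kSpan-isolated : ∀ {n} {a b : Fin n} (Y : EdgeList n) → a ≢ b → covB Y b ≡ false → kSpan Y ≡ suc (kSpan ((a , b) ∷ Y))
  kSpan-isolated {a = a} {b} Y ne nb =
    kSpan-nconn Y a b (λ c → true≢false (trans (sym (conn-covered (λ q → ne (sym q)) (conn-sym c))) nb))

  kCov-isolated : ∀ {n} {a b : Fin n} (Y : EdgeList n) → a ≢ b → covB Y a ≡ false → covB Y b ≡ false →
    kCov ((a , b) ∷ Y) ≡ suc (kCov Y)
  kCov-isolated {a = a} {b} Y ne na nb = sym (ℕP.+-cancelʳ-≡ U' _ _ (trans (sym (ℕP.+-suc (kCov Y) U')) (ℕP.suc-injective (trans
     (sym (ℕP.+-suc (kCov Y) (suc U'))) (trans (cong (kCov Y +_) (sym two-fewer)) (trans (kCov+uncov Y)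
     (trans (kSpan-isolated Y ne nb) (cong suc (sym (kCov+uncov ((a , b) ∷ Y)))))))))))
    where
    U' = uncov ((a , b) ∷ Y)
    two-fewer : uncov Y ≡ suc (suc U')
    two-fewer = trans (uncov-cons a b Y) (trans (cong (λ p → bit (not p) + (bit (not (covB Y b) ∧ not (eqb b a)) + U')) na)
          (trans (cong (λ q → 1 + (bit (not q ∧ not (eqb b a)) + U')) nb)
            (cong (λ r → 1 + (bit (not r) + U')) (eqb-≢ (λ q → ne (sym q))))))

  kSpan-loop : ∀ {n} (a : Fin n) (Y : EdgeList n) → kSpan ((a , a) ∷ Y) ≡ kSpan Y
  kSpan-loop a Y = kSpan-conn Y a a ε

  kCov-loop-touching : ∀ {n} (a : Fin n) (Y : EdgeList n) → covB Y a ≡ true → kCov ((a , a) ∷ Y) ≡ kCov Y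
  kCov-loop-touching a Y t = ℕP.+-cancelʳ-≡ (uncov Y) _ _ (trans (cong (kCov ((a , a) ∷ Y) +_) same-uncov)
      (trans (kCov+uncov ((a , a) ∷ Y)) (trans (kSpan-loop a Y) (sym (kCov+uncov Y)))))
    where
    same-uncov : uncov Y ≡ uncov ((a , a) ∷ Y)
    same-uncov = trans (uncov-cons a a Y) (cong₂ (λ p q → bit (not p) + (bit (not p ∧ not q) + uncov ((a , a) ∷ Y))) t (eqb-refl a))

  kCov-loop-isolated : ∀ {n} (a : Fin n) (Y : EdgeList n) → covB Y a ≡ false → kCov ((a , a) ∷ Y) ≡ suc (kCov Y)
  kCov-loop-isolated a Y f = sym (ℕP.+-cancelʳ-≡ U' _ _ (trans (sym (ℕP.+-suc (kCov Y) U')) (trans (cong (kCov Y +_) (sym one-fewer))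
      (trans (kCov+uncov Y) (trans (sym (kSpan-loop a Y)) (sym (kCov+uncov ((a , a) ∷ Y))))))))
    where
    U' = uncov ((a , a) ∷ Y)
    one-fewer : uncov Y ≡ suc U'
    one-fewer = trans (uncov-cons a a Y) (cong₂ (λ p q → bit (not p) + (bit (not p ∧ not q) + U')) f (eqb-refl a))

  kSpan-mid : ∀ {n} (e : Fin n × Fin n) (X Y : EdgeList n) → kSpan (X ++ e ∷ Y) ≡ kSpan (e ∷ (X ++ Y))
  kSpan-mid e X Y = kSpan-same to-front from-front
    where
    to-front : Sub (X ++ e ∷ Y) (e ∷ (X ++ Y))
    to-front m with ∈-++⁻ X m
    ... | inj₁ mx = there (∈-++⁺ˡ mx)
    ... | inj₂ (here p) = here p
    ... | inj₂ (there my) = there (∈-++⁺ʳ X my)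
    from-front : Sub (e ∷ (X ++ Y)) (X ++ e ∷ Y)
    from-front (here p) = ∈-++⁺ʳ X (here p)
    from-front (there m) with ∈-++⁻ X m
    ... | inj₁ mx = ∈-++⁺ˡ mx
    ... | inj₂ my = ∈-++⁺ʳ X (there my)

  length-contract : ∀ n u v (L : EdgeList n) → length (edges (contract (mkG n ((u , v) ∷ L)) zero)) ≤ length L
  length-contract (suc k) u v L with u ≟ v
  ... | yes _ = ℕP.≤-refl
  ... | no _  = ℕP.≤-reflexive (length-map _ L)

  length-dagger : ∀ n u v (L : EdgeList n) → length (edges (dagger (mkG n ((u , v) ∷ L)) zero)) ≤ length L
  length-dagger (suc k) u v L with u ≟ v
  ... | yes refl = ℕP.≤-trans (ℕP.≤-reflexive (cong length (removeVertex-touch u u u L (inj₁ refl)))) (removeVertex-length≤ L u)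
  length-dagger (suc zero) zero zero L | no ne = ⊥-elim (ne refl)
  length-dagger (suc (suc k)) u v L | no ne =
    ℕP.≤-trans (removeVertex-length≤ (removeVertex ((u , v) ∷ L) u) (punchOut ne))
      (ℕP.≤-trans (ℕP.≤-reflexive (cong length (removeVertex-touch u u v L (inj₁ refl)))) (removeVertex-length≤ L u))

module SubsetSums {c ℓ} (Rg : CommutativeRing c ℓ) where
  open Components

  open import Data.Nat using (suc)
  open import Data.Fin using (Fin; punchOut)
  open import Data.Fin.Properties using (_≟_)
  open import Data.Bool using (Bool; true; false; if_then_else_)
  open import Data.Product using (_,_)
  open import Data.Sum using (inj₁; inj₂)
  open import Data.List.Relation.Unary.Any using (here)
  open import Data.List using (List; []; _∷_; _++_; map; length; concatMap)
  open import Data.Vec using (_∷_)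
  open import Relation.Nullary using (yes; no)
  open import Relation.Binary.PropositionalEquality as P using (_≡_)
  open CommutativeRing Rg
  open Expansion Rg using (ringSum)
  open import Relation.Binary.Reasoning.Setoid setoid
  open import Algebra.Properties.CommutativeSemigroup +-commutativeSemigroup using (interchange)

  ringSum-++ : ∀ xs ys → ringSum (xs ++ ys) ≈ ringSum xs + ringSum ys
  ringSum-++ []       ys = sym (+-identityˡ _)
  ringSum-++ (x ∷ xs) ys = trans (+-congˡ (ringSum-++ xs ys)) (sym (+-assoc _ _ _))

  ringSum-concatMap : ∀ {A : Set} (f : A → List Carrier) xs →
    ringSum (concatMap f xs) ≈ ringSum (map (λ a → ringSum (f a)) xs)
  ringSum-concatMap f []       = refl
  ringSum-concatMap f (x ∷ xs) = trans (ringSum-++ (f x) (concatMap f xs)) (+-congˡ (ringSum-concatMap f xs))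

  ringSum-map-cong : ∀ {A : Set} {f g : A → Carrier} xs → (∀ a → f a ≈ g a) → ringSum (map f xs) ≈ ringSum (map g xs)
  ringSum-map-cong []       e = refl
  ringSum-map-cong (x ∷ xs) e = +-cong (e x) (ringSum-map-cong xs e)

  ringSum-map-+ : ∀ {A : Set} (f g : A → Carrier) xs →
    ringSum (map (λ a → f a + g a) xs) ≈ ringSum (map f xs) + ringSum (map g xs)
  ringSum-map-+ f g []       = sym (+-identityˡ _)
  ringSum-map-+ f g (x ∷ xs) = trans (+-congˡ (ringSum-map-+ f g xs)) (interchange _ _ _ _)

  ringSum-map-* : ∀ {A : Set} (k : Carrier) (f : A → Carrier) xs → ringSum (map (λ a → k * f a) xs) ≈ k * ringSum (map f xs)
  ringSum-map-* k f []       = sym (zeroʳ k)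
  ringSum-map-* k f (x ∷ xs) = trans (+-congˡ (ringSum-map-* k f xs)) (sym (distribˡ k _ _))

  ringSum-map-0 : ∀ {A : Set} (xs : List A) → ringSum (map (λ _ → 0#) xs) ≈ 0#
  ringSum-map-0 []       = refl
  ringSum-map-0 (x ∷ xs) = trans (+-identityˡ _) (ringSum-map-0 xs)

  sumSub : ∀ {X : Set} (L : List X) → (List X → Carrier) → Carrier
  sumSub L h = ringSum (map (λ S → h (selected L S)) (allSubsets (length L)))

  sumSub-cong : ∀ {X : Set} (L : List X) {h h'} → (∀ S → h S ≈ h' S) → sumSub L h ≈ sumSub L h'
  sumSub-cong L e = ringSum-map-cong (allSubsets (length L)) (λ S → e (selected L S))

  sumSub-+ : ∀ {X : Set} (L : List X) f g → sumSub L (λ S → f S + g S) ≈ sumSub L f + sumSub L g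
  sumSub-+ L f g = ringSum-map-+ _ _ (allSubsets (length L))

  sumSub-* : ∀ {X : Set} (L : List X) k f → sumSub L (λ S → k * f S) ≈ k * sumSub L f
  sumSub-* L k f = ringSum-map-* k _ (allSubsets (length L))

  sumSub-0 : ∀ {X : Set} (L : List X) → sumSub L (λ _ → 0#) ≈ 0#
  sumSub-0 L = ringSum-map-0 (allSubsets (length L))

  sumSub-[] : ∀ {X : Set} h → sumSub {X} [] h ≈ h []
  sumSub-[] h = +-identityʳ _

  sumSub-∷ : ∀ {X : Set} (e : X) (L : List X) h → sumSub (e ∷ L) h ≈ sumSub L h + sumSub L (λ S → h (e ∷ S))
  sumSub-∷ e L h = split (allSubsets (length L))
    where
    g = λ S → h (selected (e ∷ L) S)
    split : ∀ xs → ringSum (map g (concatMap (λ s → (false ∷ s) ∷ (true ∷ s) ∷ []) xs))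
                   ≈ ringSum (map (λ s → g (false ∷ s)) xs) + ringSum (map (λ s → g (true ∷ s)) xs)
    split [] = sym (+-identityˡ _)
    split (s ∷ xs) = begin
      g (false ∷ s) + (g (true ∷ s) + ringSum (map g (concatMap _ xs))) ≈⟨ +-congˡ (+-congˡ (split xs)) ⟩
      g (false ∷ s) + (g (true ∷ s) + (A + B))                          ≈⟨ sym (+-assoc _ _ _) ⟩
      (g (false ∷ s) + g (true ∷ s)) + (A + B)                          ≈⟨ interchange _ _ _ _ ⟩
      (g (false ∷ s) + A) + (g (true ∷ s) + B)                          ∎
      where
      A = ringSum (map (λ s → g (false ∷ s)) xs)
      B = ringSum (map (λ s → g (true ∷ s)) xs)

  sumSub-map : ∀ {X Y : Set} (f : X → Y) (L : List X) h → sumSub (map f L) h ≈ sumSub L (λ S → h (map f S))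
  sumSub-map f [] h = refl
  sumSub-map f (a ∷ L) h = begin
    sumSub (f a ∷ map f L) h                                                 ≈⟨ sumSub-∷ (f a) (map f L) h ⟩
    sumSub (map f L) h + sumSub (map f L) (λ S → h (f a ∷ S))                 ≈⟨ +-cong (sumSub-map f L h) (sumSub-map f L (λ S → h (f a ∷ S))) ⟩
    sumSub L (λ S → h (map f S)) + sumSub L (λ S → h (f a ∷ map f S))         ≈⟨ sym (sumSub-∷ a L (λ S → h (map f S))) ⟩
    sumSub (a ∷ L) (λ S → h (map f S))                                       ∎

  sumSub-∷-vanishing : ∀ {X : Set} (e : X) (L : List X) F → (∀ S → F (e ∷ S) ≈ 0#) → sumSub (e ∷ L) F ≈ sumSub L F
  sumSub-∷-vanishing e L F z = begin
    sumSub (e ∷ L) F                              ≈⟨ sumSub-∷ e L F ⟩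
    sumSub L F + sumSub L (λ S → F (e ∷ S))       ≈⟨ +-congˡ (trans (sumSub-cong L z) (sumSub-0 L)) ⟩
    sumSub L F + 0#                               ≈⟨ +-identityʳ _ ⟩
    sumSub L F                                    ∎

  unless : Bool → Carrier → Carrier
  unless b t = if b then 0# else t

  unless-true : ∀ {b} t → b ≡ true → unless b t ≈ 0#
  unless-true t P.refl = refl

  unless-0 : ∀ b → unless b 0# ≈ 0#
  unless-0 true  = refl
  unless-0 false = refl

  unless-cong : ∀ b {t t'} → t ≈ t' → unless b t ≈ unless b t'
  unless-cong true  e = refl
  unless-cong false e = e

  unless-sumSub : ∀ {X : Set} b (L : List X) f → unless b (sumSub L f) ≈ sumSub L (λ S → unless b (f S))
  unless-sumSub true  L f = sym (sumSub-0 L)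
  unless-sumSub false L f = refl

  sumSub-removeVertex : ∀ {k} (w : Fin (suc k)) (L : EdgeList (suc k)) h →
    sumSub (removeVertex L w) h ≈ sumSub L (λ X → unless (covB X w) (h (removeVertex X w)))
  sumSub-removeVertex w [] h = refl
  sumSub-removeVertex w ((a , b) ∷ L) h with w ≟ a | w ≟ b
  ... | no ha | no hb = begin
      sumSub (e' ∷ removeVertex L w) h                                   ≈⟨ sumSub-∷ e' (removeVertex L w) h ⟩
      sumSub (removeVertex L w) h + sumSub (removeVertex L w) (λ S → h (e' ∷ S))
        ≈⟨ +-cong (sumSub-removeVertex w L h) (sumSub-removeVertex w L (λ S → h (e' ∷ S))) ⟩
      sumSub L F + sumSub L (λ X → unless (covB X w) (h (e' ∷ removeVertex X w)))  ≈⟨ +-congˡ (sumSub-cong L avoid-edge) ⟩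
      sumSub L F + sumSub L (λ S → F ((a , b) ∷ S))                      ≈⟨ sym (sumSub-∷ (a , b) L F) ⟩
      sumSub ((a , b) ∷ L) F                                             ∎
    where
    e' = (punchOut ha , punchOut hb)
    F = λ X → unless (covB X w) (h (removeVertex X w))
    avoid-edge : ∀ S → unless (covB S w) (h (e' ∷ removeVertex S w)) ≈ F ((a , b) ∷ S)
    avoid-edge S rewrite eqb-≢ ha | eqb-≢ hb | removeVertex-avoid w a b S ha hb = refl
  ... | yes p | _     = trans (sumSub-removeVertex w L h) (sym (sumSub-∷-vanishing (a , b) L F
                          (λ S → unless-true _ (covB⇐ ((a , b) ∷ S) w (here P.refl) (inj₁ p)))))
    where F = λ X → unless (covB X w) (h (removeVertex X w))
  ... | no _  | yes p = trans (sumSub-removeVertex w L h) (sym (sumSub-∷-vanishing (a , b) L F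
                          (λ S → unless-true _ (covB⇐ ((a , b) ∷ S) w (here P.refl) (inj₂ p)))))
    where F = λ X → unless (covB X w) (h (removeVertex X w))

  sumPairs : ∀ {X : Set} (L : List X) → (List X → List X → Carrier) → Carrier
  sumPairs L F = sumSub L (λ A → sumSub L (F A))

  sumPairs-cong : ∀ {X : Set} (L : List X) {F G} → (∀ A B → F A B ≈ G A B) → sumPairs L F ≈ sumPairs L G
  sumPairs-cong L e = sumSub-cong L (λ A → sumSub-cong L (e A))

  sumPairs-+ : ∀ {X : Set} (L : List X) F G → sumPairs L (λ A B → F A B + G A B) ≈ sumPairs L F + sumPairs L G
  sumPairs-+ L F G = trans (sumSub-cong L (λ A → sumSub-+ L (F A) (G A))) (sumSub-+ L (λ A → sumSub L (F A)) (λ A → sumSub L (G A)))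

  sumPairs-0 : ∀ {X : Set} (L : List X) → sumPairs L (λ _ _ → 0#) ≈ 0#
  sumPairs-0 L = trans (sumSub-cong L (λ _ → sumSub-0 L)) (sumSub-0 L)

  sumPairs-* : ∀ {X : Set} (L : List X) k F → sumPairs L (λ A B → k * F A B) ≈ k * sumPairs L F
  sumPairs-* L k F = trans (sumSub-cong L (λ A → sumSub-* L k (F A))) (sumSub-* L k (λ A → sumSub L (F A)))

  sumPairs-∷ : ∀ {X : Set} (e : X) (L : List X) F →
    sumPairs (e ∷ L) F ≈ (sumPairs L F + sumPairs L (λ A B → F A (e ∷ B)))
                       + (sumPairs L (λ A B → F (e ∷ A) B) + sumPairs L (λ A B → F (e ∷ A) (e ∷ B)))
  sumPairs-∷ e L F = begin
    sumPairs (e ∷ L) F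
      ≈⟨ sumSub-∷ e L (λ A → sumSub (e ∷ L) (F A)) ⟩
    sumSub L (λ A → sumSub (e ∷ L) (F A)) + sumSub L (λ A → sumSub (e ∷ L) (F (e ∷ A)))
      ≈⟨ +-cong (sumSub-cong L (λ A → sumSub-∷ e L (F A))) (sumSub-cong L (λ A → sumSub-∷ e L (F (e ∷ A)))) ⟩
    sumSub L (λ A → sumSub L (F A) + sumSub L (λ B → F A (e ∷ B)))
      + sumSub L (λ A → sumSub L (F (e ∷ A)) + sumSub L (λ B → F (e ∷ A) (e ∷ B)))
      ≈⟨ +-cong (sumSub-+ L (λ A → sumSub L (F A)) (λ A → sumSub L (λ B → F A (e ∷ B))))
                (sumSub-+ L (λ A → sumSub L (F (e ∷ A))) (λ A → sumSub L (λ B → F (e ∷ A) (e ∷ B)))) ⟩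
    (sumPairs L F + sumPairs L (λ A B → F A (e ∷ B)))
      + (sumPairs L (λ A B → F (e ∷ A) B) + sumPairs L (λ A B → F (e ∷ A) (e ∷ B))) ∎

  sumPairs-pullback : ∀ {A B : Set} (D : List B) (L : List A) (p : List A → Bool) (ρ : List A → List B) →
    (∀ h → sumSub D h ≈ sumSub L (λ X → unless (p X) (h (ρ X)))) →
    ∀ F → sumPairs D F ≈ sumPairs L (λ X Y → unless (p X) (unless (p Y) (F (ρ X) (ρ Y))))
  sumPairs-pullback D L p ρ hD F = begin
    sumSub D (λ S → sumSub D (F S))
      ≈⟨ hD (λ S → sumSub D (F S)) ⟩
    sumSub L (λ X → unless (p X) (sumSub D (F (ρ X))))
      ≈⟨ sumSub-cong L (λ X → unless-cong (p X) (hD (F (ρ X)))) ⟩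
    sumSub L (λ X → unless (p X) (sumSub L (λ Y → unless (p Y) (F (ρ X) (ρ Y)))))
      ≈⟨ sumSub-cong L (λ X → unless-sumSub (p X) L (λ Y → unless (p Y) (F (ρ X) (ρ Y)))) ⟩
    sumPairs L (λ X Y → unless (p X) (unless (p Y) (F (ρ X) (ρ Y)))) ∎

module Recurrence {c ℓ} (Rg : CommutativeRing c ℓ) (x y z : CommutativeRing.Carrier Rg) where
  open Components
  open SubsetSums Rg

  open import Data.Nat as ℕ using (ℕ; zero; suc; _∸_; _≤_)
  import Data.Nat.Properties as ℕP
  open import Data.Fin using (Fin; zero; suc; punchOut)
  open import Data.Fin.Properties using (_≟_; punchIn-punchOut)
  open import Data.Bool using (Bool; true; false; _∧_; _∨_; not; if_then_else_)
  open import Data.Bool.Properties using (∧-zeroʳ; ∧-identityʳ; ∧-idem; ∨-idem)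
  open import Data.Product using (_×_; _,_; proj₁; proj₂)
  open import Data.Sum using (inj₁)
  open import Data.Empty using (⊥; ⊥-elim)
  open import Data.List using ([]; _∷_; _++_; length)
  open import Data.List.Properties using (length-map; map-++)
  open import Relation.Nullary using (yes; no)
  import Relation.Binary.PropositionalEquality as P
  open P using (_≡_; _≢_)
  open CommutativeRing Rg hiding (zero)
  open Expansion Rg
  open import Relation.Binary.Reasoning.Setoid setoid

  monomial : ℕ → ℕ → ℕ → Carrier
  monomial s l k = pow x (s ∸ k) * pow y (l ∸ k) * pow z k

  monomial-≡ : ∀ {s s' l l' k k'} → s ≡ s' → l ≡ l' → k ≡ k' → monomial s l k ≈ monomial s' l' k'
  monomial-≡ P.refl P.refl P.refl = refl

  monomial-y : ∀ s l k → k ≤ l → monomial s (suc l) k ≈ y * monomial s l k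
  monomial-y s l k k≤l = begin
    a * pow y (suc l ∸ k) * d      ≈⟨ reflexive (P.cong (λ t → a * pow y t * d) (ℕP.+-∸-assoc 1 k≤l)) ⟩
    a * (y * b) * d                ≈⟨ *-congʳ (trans (sym (*-assoc a y b)) (trans (*-congʳ (*-comm a y)) (*-assoc y a b))) ⟩
    y * (a * b) * d                ≈⟨ *-assoc y (a * b) d ⟩
    y * (a * b * d)                ∎
    where
    a = pow x (s ∸ k)
    b = pow y (l ∸ k)
    d = pow z k

  monomial-z : ∀ s l k → monomial (suc s) (suc l) (suc k) ≈ z * monomial s l k
  monomial-z s l k = begin
    ab * (z * d)     ≈⟨ sym (*-assoc ab z d) ⟩
    ab * z * d       ≈⟨ *-congʳ (*-comm ab z) ⟩
    z * ab * d       ≈⟨ *-assoc z ab d ⟩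
    z * (ab * d)     ∎
    where
    ab = pow x (s ∸ k) * pow y (l ∸ k)
    d = pow z k

  weight : ∀ {n} → EdgeList n → EdgeList n → Carrier
  weight A B = if djB A B then monomial (kSpan (A ++ B)) (length A ℕ.+ length B) (kCov B) else 0#

  expansion : ∀ {n} → EdgeList n → Carrier
  expansion L = sumPairs L weight

  subgraphSum≈expansion : ∀ n (es : EdgeList n) → subgraphSum x y z (mkG n es) ≈ expansion es
  subgraphSum≈expansion n es = ringSum-concatMap _ (allSubsets (length es))

  kCov≤lengths : ∀ {n} (A B : EdgeList n) → kCov B ≤ length A ℕ.+ length B
  kCov≤lengths A B = ℕP.≤-trans (kCov≤length B) (ℕP.m≤n+m (length B) (length A))

  weight-scaled : ∀ {n m} (A B : EdgeList n) (A' B' : EdgeList m) r → djB A B ≡ djB A' B' →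
    (djB A B ≡ true → monomial (kSpan (A ++ B)) (length A ℕ.+ length B) (kCov B)
                     ≈ r * monomial (kSpan (A' ++ B')) (length A' ℕ.+ length B') (kCov B')) →
    weight A B ≈ r * weight A' B'
  weight-scaled A B A' B' r same scale with djB A B
  ... | true  rewrite P.sym same = scale P.refl
  ... | false rewrite P.sym same = sym (zeroʳ r)

  touches : ∀ {n} → Fin n × Fin n → EdgeList n → Bool
  touches (a , b) X = covB X a ∨ covB X b

  meet-at-edge : ∀ d a b → a ∨ b ≡ true → d ∧ not a ∧ not b ≡ false
  meet-at-edge d true  b     _ = ∧-zeroʳ d
  meet-at-edge d false true  _ = ∧-zeroʳ d

  weight-touching-left : ∀ {n} (e : Fin n × Fin n) A B → touches e B ≡ true → weight (e ∷ A) B ≈ 0#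
  weight-touching-left (a , b) A B t
    rewrite djB-consL a b A B | meet-at-edge (djB A B) (covB B a) (covB B b) t = refl

  weight-touching-right : ∀ {n} (e : Fin n × Fin n) A B → touches e A ≡ true → weight A (e ∷ B) ≈ 0#
  weight-touching-right (a , b) A B t
    rewrite djB-consR a b A B | meet-at-edge (djB A B) (covB A a) (covB A b) t = refl

  pair-split : ∀ {n} (e : Fin n × Fin n) (G R : EdgeList n → EdgeList n → Carrier) A B →
    (touches e B ≡ true → weight A (e ∷ B) ≈ y * G A B) →
    (touches e B ≡ false → weight (e ∷ A) B ≈ y * G A B) →
    (touches e B ≡ false → touches e A ≡ false → weight A (e ∷ B) ≈ z * R A B) →
    weight A (e ∷ B) + weight (e ∷ A) B ≈ y * G A B + z * unless (touches e A) (unless (touches e B) (R A B))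
  pair-split e G R A B into-B-touching into-A into-B-avoiding with touches e B in tB
  ... | true = begin
    weight A (e ∷ B) + weight (e ∷ A) B   ≈⟨ +-cong (into-B-touching P.refl) (weight-touching-left e A B tB) ⟩
    y * G A B + 0#                        ≈⟨ +-congˡ (sym (trans (*-congˡ (unless-0 (touches e A))) (zeroʳ z))) ⟩
    y * G A B + z * unless (touches e A) 0# ∎
  ... | false with touches e A in tA
  ...   | true = begin
    weight A (e ∷ B) + weight (e ∷ A) B   ≈⟨ +-cong (weight-touching-right e A B tA) (into-A P.refl) ⟩
    0# + y * G A B                        ≈⟨ +-comm 0# _ ⟩
    y * G A B + 0#                        ≈⟨ +-congˡ (sym (zeroʳ z)) ⟩
    y * G A B + z * 0#                    ∎
  ...   | false = begin
    weight A (e ∷ B) + weight (e ∷ A) B   ≈⟨ +-cong (into-B-avoiding P.refl P.refl) (into-A P.refl) ⟩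
    z * R A B + y * G A B                 ≈⟨ +-comm _ _ ⟩
    y * G A B + z * R A B                 ∎

  expansion-∷ : ∀ {n} (e : Fin n × Fin n) (L : EdgeList n) (G Z : EdgeList n → EdgeList n → Carrier) →
    (∀ A B → weight A (e ∷ B) + weight (e ∷ A) B ≈ y * G A B + z * Z A B) →
    expansion (e ∷ L) ≈ expansion L + y * sumPairs L G + z * sumPairs L Z
  expansion-∷ e@(a , b) L G Z per-pair = begin
    expansion (e ∷ L)
      ≈⟨ sumPairs-∷ e L weight ⟩
    (E + P) + (Q + sumPairs L (λ A B → weight (e ∷ A) (e ∷ B)))
      ≈⟨ +-congˡ (+-congˡ (trans (sumPairs-cong L both) (sumPairs-0 L))) ⟩
    (E + P) + (Q + 0#)
      ≈⟨ +-congˡ (+-identityʳ Q) ⟩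
    (E + P) + Q
      ≈⟨ +-assoc E P Q ⟩
    E + (P + Q)
      ≈⟨ +-congˡ (sym (sumPairs-+ L (λ A B → weight A (e ∷ B)) (λ A B → weight (e ∷ A) B))) ⟩
    E + sumPairs L (λ A B → weight A (e ∷ B) + weight (e ∷ A) B)
      ≈⟨ +-congˡ (sumPairs-cong L per-pair) ⟩
    E + sumPairs L (λ A B → y * G A B + z * Z A B)
      ≈⟨ +-congˡ (trans (sumPairs-+ L (λ A B → y * G A B) (λ A B → z * Z A B)) (+-cong (sumPairs-* L y G) (sumPairs-* L z Z))) ⟩
    E + (y * sumPairs L G + z * sumPairs L Z)
      ≈⟨ sym (+-assoc E _ _) ⟩
    E + y * sumPairs L G + z * sumPairs L Z ∎
    where
    E = expansion L
    P = sumPairs L (λ A B → weight A (e ∷ B))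
    Q = sumPairs L (λ A B → weight (e ∷ A) B)
    both : ∀ A B → weight (e ∷ A) (e ∷ B) ≈ 0#
    both A B = weight-touching-left e A (e ∷ B) (∨-true-l _ (∨-true-l _ (∨-true-l _ (eqb-refl a))))

  length-∷-right : ∀ {n} (e : Fin n × Fin n) (A B : EdgeList n) → length A ℕ.+ length (e ∷ B) ≡ suc (length A ℕ.+ length B)
  length-∷-right e A B = ℕP.+-suc (length A) (length B)

  -- The recurrence for a proper edge e = (u , v): contraction merges u and v,
  -- deletion of both endpoints removes u and then (the image v' of) v.
  module ProperEdge {k} (u v : Fin (suc (suc k))) (u≢v : u ≢ v) where
    open Merge u v u≢v

    v' : Fin (suc k)
    v' = punchOut u≢v

    removeUV : EdgeList (suc (suc k)) → EdgeList k
    removeUV X = removeVertex (removeVertex X u) v'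

    covB-v' : ∀ X → covB X u ≡ false → covB (removeVertex X u) v' ≡ covB X v
    covB-v' X eu = P.trans (covB-removeVertex u X eu v') (P.cong (covB X) (punchIn-punchOut u≢v))

    avoid-u : ∀ X → touches e X ≡ false → covB X u ≡ false
    avoid-u X t = proj₁ (∨-false {covB X u} t)

    avoid-v : ∀ X → touches e X ≡ false → covB X v ≡ false
    avoid-v X t = proj₂ (∨-false {covB X u} t)

    avoid-v' : ∀ X → touches e X ≡ false → covB (removeVertex X u) v' ≡ false
    avoid-v' X t = P.trans (covB-v' X (avoid-u X t)) (avoid-v X t)

    lengths-merge : ∀ A B → length A ℕ.+ length B ≡ length (mergeAll A) ℕ.+ length (mergeAll B)
    lengths-merge A B = P.sym (P.cong₂ ℕ._+_ (length-map mergeEdge A) (length-map mergeEdge B))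

    kSpan-mergeAll-++ : ∀ A B → kSpan (e ∷ (A ++ B)) ≡ kSpan (mergeAll A ++ mergeAll B)
    kSpan-mergeAll-++ A B = P.trans (kSpan-merge (A ++ B)) (P.cong kSpan (map-++ mergeEdge A B))

    -- If B touches u or v, a pair disjoint from B must avoid that endpoint; so merging
    -- u and v keeps A and e ∷ B disjoint exactly when it keeps A and B disjoint.
    disjoint-touching : ∀ d a b c e → (d ≡ true → a ≡ true → c ≡ true → ⊥) → (d ≡ true → b ≡ true → e ≡ true → ⊥) →
      c ∨ e ≡ true → d ∧ not a ∧ not b ≡ d ∧ not (a ∧ e) ∧ not (b ∧ c)
    disjoint-touching false a     b     c     e     h1 h2 t = P.refl
    disjoint-touching true  true  b     true  e     h1 h2 t = ⊥-elim (h1 P.refl P.refl P.refl)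
    disjoint-touching true  true  b     false true  h1 h2 t = P.refl
    disjoint-touching true  false false c     e     h1 h2 t = P.refl
    disjoint-touching true  false true  c     true  h1 h2 t = ⊥-elim (h2 P.refl P.refl P.refl)
    disjoint-touching true  false true  true  false h1 h2 t = P.refl

    merge-touching : ∀ A B → touches e B ≡ true → weight A (e ∷ B) ≈ y * weight (mergeAll A) (mergeAll B)
    merge-touching A B t = weight-scaled A (e ∷ B) (mergeAll A) (mergeAll B) y same-disjointness λ _ →
      trans (monomial-≡ (P.trans (kSpan-mid e A B) (kSpan-mergeAll-++ A B))
                        (P.trans (length-∷-right e A B) (P.cong suc (lengths-merge A B)))
                        (kCov-merge-touching B t))
            (monomial-y _ _ _ (kCov≤lengths (mergeAll A) (mergeAll B)))
      where
      same-disjointness : djB A (e ∷ B) ≡ djB (mergeAll A) (mergeAll B)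
      same-disjointness = P.trans (djB-consR u v A B)
        (P.trans (disjoint-touching (djB A B) (covB A u) (covB A v) (covB B u) (covB B v)
                    (λ d a c → djB⇒ A B d u a c) (λ d b c → djB⇒ A B d v b c) t)
                 (P.sym (djB-merge A B)))

    merge-avoiding : ∀ A B → touches e B ≡ false → weight (e ∷ A) B ≈ y * weight (mergeAll A) (mergeAll B)
    merge-avoiding A B t = weight-scaled (e ∷ A) B (mergeAll A) (mergeAll B) y same-disjointness λ _ →
      trans (monomial-≡ (kSpan-mergeAll-++ A B) (P.cong suc (lengths-merge A B)) (kCov-merge-avoiding B (avoid-v B t)))
            (monomial-y _ _ _ (kCov≤lengths (mergeAll A) (mergeAll B)))
      where
      same-disjointness : djB (e ∷ A) B ≡ djB (mergeAll A) (mergeAll B)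
      same-disjointness rewrite djB-consL u v A B | djB-merge A B | avoid-u B t | avoid-v B t
                              | ∧-zeroʳ (covB A u) | ∧-zeroʳ (covB A v) = P.refl

    remove-both : ∀ A B → touches e B ≡ false → touches e A ≡ false →
      weight A (e ∷ B) ≈ z * weight (removeUV A) (removeUV B)
    remove-both A B tB tA = weight-scaled A (e ∷ B) (removeUV A) (removeUV B) z same-disjointness λ _ →
      trans (monomial-≡ components lengths covered-components)
            (monomial-z (kSpan (removeUV A ++ removeUV B)) (length (removeUV A) ℕ.+ length (removeUV B)) (kCov (removeUV B)))
      where
      AB = A ++ B
      tAB : touches e AB ≡ false
      tAB rewrite covB-++ A B u | covB-++ A B v | avoid-u A tA | avoid-u B tB | avoid-v A tA | avoid-v B tB = P.refl
      same-disjointness : djB A (e ∷ B) ≡ djB (removeUV A) (removeUV B)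
      same-disjointness rewrite djB-consR u v A B | avoid-u A tA | avoid-v A tA | ∧-identityʳ (djB A B) =
        P.trans (djB-removeVertex u A B (avoid-u A tA) (avoid-u B tB))
                (djB-removeVertex v' (removeVertex A u) (removeVertex B u) (avoid-v' A tA) (avoid-v' B tB))
      components : kSpan (A ++ e ∷ B) ≡ suc (kSpan (removeUV A ++ removeUV B))
      components = P.trans (kSpan-mid e A B) (ℕP.suc-injective (P.trans (P.sym (kSpan-isolated AB u≢v (avoid-v AB tAB)))
        (P.trans (kSpan-removeVertex u AB (avoid-u AB tAB)) (P.cong suc
          (P.trans (kSpan-removeVertex v' (removeVertex AB u) (avoid-v' AB tAB))
                   (P.cong (λ L → suc (kSpan L)) (P.trans (P.cong (λ L → removeVertex L v') (removeVertex-++ A B u))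
                                                           (removeVertex-++ (removeVertex A u) (removeVertex B u) v'))))))))
      length-removeUV : ∀ X → touches e X ≡ false → length (removeUV X) ≡ length X
      length-removeUV X t = P.trans (removeVertex-length v' (removeVertex X u) (avoid-v' X t)) (removeVertex-length u X (avoid-u X t))
      lengths : length A ℕ.+ length (e ∷ B) ≡ suc (length (removeUV A) ℕ.+ length (removeUV B))
      lengths = P.trans (length-∷-right e A B) (P.cong suc (P.sym (P.cong₂ ℕ._+_ (length-removeUV A tA) (length-removeUV B tB))))
      covered-components : kCov (e ∷ B) ≡ suc (kCov (removeUV B))
      covered-components = P.trans (kCov-isolated B u≢v (avoid-u B tB) (avoid-v B tB))
        (P.cong suc (P.trans (kCov-removeVertex u B (avoid-u B tB)) (kCov-removeVertex v' (removeVertex B u) (avoid-v' B tB))))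

    sumSub-removeUV : ∀ L h → sumSub (removeUV L) h ≈ sumSub L (λ X → unless (touches e X) (h (removeUV X)))
    sumSub-removeUV L h = begin
      sumSub (removeUV L) h
        ≈⟨ sumSub-removeVertex v' (removeVertex L u) h ⟩
      sumSub (removeVertex L u) (λ X₁ → unless (covB X₁ v') (h (removeVertex X₁ v')))
        ≈⟨ sumSub-removeVertex u L (λ X₁ → unless (covB X₁ v') (h (removeVertex X₁ v'))) ⟩
      sumSub L (λ X → unless (covB X u) (unless (covB (removeVertex X u) v') (h (removeUV X))))
        ≈⟨ sumSub-cong L nested-unless ⟩
      sumSub L (λ X → unless (touches e X) (h (removeUV X))) ∎
      where
      nested-unless : ∀ X → unless (covB X u) (unless (covB (removeVertex X u) v') (h (removeUV X)))
                            ≈ unless (touches e X) (h (removeUV X))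
      nested-unless X with covB X u in eu
      ... | true  = refl
      ... | false rewrite covB-v' X eu = refl

    expansion-rec : ∀ L → expansion (e ∷ L) ≈ expansion L + y * expansion (mergeAll L) + z * expansion (removeUV L)
    expansion-rec L = begin
      expansion (e ∷ L)
        ≈⟨ expansion-∷ e L G Z (λ A B → pair-split e G R A B (merge-touching A B) (merge-avoiding A B) (remove-both A B)) ⟩
      expansion L + y * sumPairs L G + z * sumPairs L Z
        ≈⟨ sym (+-cong (+-congˡ (*-congˡ merged)) (*-congˡ removed)) ⟩
      expansion L + y * expansion (mergeAll L) + z * expansion (removeUV L) ∎
      where
      G = λ A B → weight (mergeAll A) (mergeAll B)
      R = λ A B → weight (removeUV A) (removeUV B)
      Z = λ A B → unless (touches e A) (unless (touches e B) (R A B))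
      merged : expansion (mergeAll L) ≈ sumPairs L G
      merged = sumPairs-pullback (mergeAll L) L (λ _ → false) mergeAll (sumSub-map mergeEdge L) weight
      removed : expansion (removeUV L) ≈ sumPairs L Z
      removed = sumPairs-pullback (removeUV L) L (touches e) removeUV (sumSub-removeUV L) weight

  -- The recurrence for a loop e = (u , u): contraction is deletion, and deletion of the
  -- endpoints removes u.
  module LoopEdge {k} (u : Fin (suc k)) where
    e : Fin (suc k) × Fin (suc k)
    e = (u , u)

    touches-loop : ∀ X → touches e X ≡ covB X u
    touches-loop X = ∨-idem (covB X u)

    -- e added to B, which contains u: a y-term, since a loop adds no component.
    loop-touching : ∀ A B → touches e B ≡ true → weight A (e ∷ B) ≈ y * weight A B
    loop-touching A B t = weight-scaled A (e ∷ B) A B y same-disjointness λ _ →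
      trans (monomial-≡ (P.trans (kSpan-mid e A B) (kSpan-loop u (A ++ B))) (length-∷-right e A B) (kCov-loop-touching u B Bu))
            (monomial-y (kSpan (A ++ B)) (length A ℕ.+ length B) (kCov B) (kCov≤lengths A B))
      where
      Bu : covB B u ≡ true
      Bu = P.trans (P.sym (touches-loop B)) t
      same-disjointness : djB A (e ∷ B) ≡ djB A B
      same-disjointness rewrite djB-consR u u A B with djB A B in d
      ... | false = P.refl
      ... | true = P.trans (∧-idem (not (covB A u))) (P.cong not (avoid (covB A u) P.refl))
        where
        avoid : ∀ b → covB A u ≡ b → b ≡ false
        avoid false _  = P.refl
        avoid true  Au = ⊥-elim (djB⇒ A B d u Au Bu)

    loop-avoiding : ∀ A B → touches e B ≡ false → weight (e ∷ A) B ≈ y * weight A B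
    loop-avoiding A B t = weight-scaled (e ∷ A) B A B y same-disjointness λ _ →
      trans (reflexive (P.cong (λ s → monomial s (suc (length A ℕ.+ length B)) (kCov B)) (kSpan-loop u (A ++ B))))
            (monomial-y (kSpan (A ++ B)) (length A ℕ.+ length B) (kCov B) (kCov≤lengths A B))
      where
      same-disjointness : djB (e ∷ A) B ≡ djB A B
      same-disjointness rewrite djB-consL u u A B | P.trans (P.sym (touches-loop B)) t = ∧-identityʳ (djB A B)

    remove-both : ∀ A B → touches e B ≡ false → touches e A ≡ false →
      weight A (e ∷ B) ≈ z * weight (removeVertex A u) (removeVertex B u)
    remove-both A B tB tA = weight-scaled A (e ∷ B) (removeVertex A u) (removeVertex B u) z same-disjointness λ _ →
      trans (monomial-≡ components lengths covered-components)
            (monomial-z (kSpan (removeVertex A u ++ removeVertex B u))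
                        (length (removeVertex A u) ℕ.+ length (removeVertex B u)) (kCov (removeVertex B u)))
      where
      Au = P.trans (P.sym (touches-loop A)) tA
      Bu = P.trans (P.sym (touches-loop B)) tB
      ABu : covB (A ++ B) u ≡ false
      ABu rewrite covB-++ A B u | Au | Bu = P.refl
      same-disjointness : djB A (e ∷ B) ≡ djB (removeVertex A u) (removeVertex B u)
      same-disjointness rewrite djB-consR u u A B | Au | ∧-identityʳ (djB A B) = djB-removeVertex u A B Au Bu
      components : kSpan (A ++ e ∷ B) ≡ suc (kSpan (removeVertex A u ++ removeVertex B u))
      components = P.trans (kSpan-mid e A B) (P.trans (kSpan-loop u (A ++ B))
        (P.trans (kSpan-removeVertex u (A ++ B) ABu) (P.cong (λ L → suc (kSpan L)) (removeVertex-++ A B u))))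
      lengths : length A ℕ.+ length (e ∷ B) ≡ suc (length (removeVertex A u) ℕ.+ length (removeVertex B u))
      lengths = P.trans (length-∷-right e A B)
        (P.cong suc (P.sym (P.cong₂ ℕ._+_ (removeVertex-length u A Au) (removeVertex-length u B Bu))))
      covered-components : kCov (e ∷ B) ≡ suc (kCov (removeVertex B u))
      covered-components = P.trans (kCov-loop-isolated u B Bu) (P.cong suc (kCov-removeVertex u B Bu))

    expansion-rec : ∀ L → expansion (e ∷ L) ≈ expansion L + y * expansion L + z * expansion (removeVertex L u)
    expansion-rec L = begin
      expansion (e ∷ L)
        ≈⟨ expansion-∷ e L weight Z (λ A B → pair-split e weight R A B (loop-touching A B) (loop-avoiding A B) (remove-both A B)) ⟩
      expansion L + y * expansion L + z * sumPairs L Z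
        ≈⟨ +-congˡ (*-congˡ (sym removed)) ⟩
      expansion L + y * expansion L + z * expansion (removeVertex L u) ∎
      where
      R = λ A B → weight (removeVertex A u) (removeVertex B u)
      Z = λ A B → unless (touches e A) (unless (touches e B) (R A B))
      removed : expansion (removeVertex L u) ≈ sumPairs L Z
      removed = sumPairs-pullback (removeVertex L u) L (touches e) (λ X → removeVertex X u)
        (λ h → trans (sumSub-removeVertex u L h)
                     (sumSub-cong L (λ X → reflexive (P.cong (λ b → unless b (h (removeVertex X u))) (P.sym (touches-loop X))))))
        weight

  RecurrentAtFirstEdge : (Graph → Carrier) → Set ℓ
  RecurrentAtFirstEdge f = ∀ n u v (L : EdgeList n) → let G = mkG n ((u , v) ∷ L) in
    f G ≈ f (delete G zero) + y * f (contract G zero) + z * f (dagger G zero)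

  subgraphSum-recurrent : RecurrentAtFirstEdge (subgraphSum x y z)
  subgraphSum-recurrent (suc k) u v L with u ≟ v
  ... | yes P.refl = begin
    subgraphSum x y z (mkG (suc k) ((u , u) ∷ L))                       ≈⟨ S≈E (suc k) ((u , u) ∷ L) ⟩
    expansion ((u , u) ∷ L)                                             ≈⟨ LoopEdge.expansion-rec u L ⟩
    expansion L + y * expansion L + z * expansion (removeVertex L u)
      ≈⟨ sym (+-cong (+-cong (S≈E (suc k) L) (*-congˡ (S≈E (suc k) L)))
                     (*-congˡ (trans (S≈E k (removeVertex ((u , u) ∷ L) u)) (reflexive (P.cong expansion (removeVertex-touch u u u L (inj₁ P.refl))))))) ⟩
    subgraphSum x y z (mkG (suc k) L) + y * subgraphSum x y z (mkG (suc k) L)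
      + z * subgraphSum x y z (mkG k (removeVertex ((u , u) ∷ L) u))     ∎
    where S≈E = subgraphSum≈expansion
  subgraphSum-recurrent (suc zero) zero zero L | no u≢v = ⊥-elim (u≢v P.refl)
  subgraphSum-recurrent (suc (suc k)) u v L | no u≢v = begin
    subgraphSum x y z (mkG (suc (suc k)) ((u , v) ∷ L))                 ≈⟨ S≈E (suc (suc k)) ((u , v) ∷ L) ⟩
    expansion ((u , v) ∷ L)                                             ≈⟨ ProperEdge.expansion-rec u v u≢v L ⟩
    expansion L + y * expansion (mergeAll L) + z * expansion (removeUV L)
      ≈⟨ sym (+-cong (+-cong (S≈E (suc (suc k)) L) (*-congˡ (S≈E (suc k) (mergeAll L))))
                     (*-congˡ (trans (S≈E k (removeVertex (removeVertex ((u , v) ∷ L) u) v')) (reflexive (P.cong (λ Q → expansion (removeVertex Q v'))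
                                                                  (removeVertex-touch u u v L (inj₁ P.refl))))))) ⟩
    subgraphSum x y z (mkG (suc (suc k)) L) + y * subgraphSum x y z (mkG (suc k) (mergeAll L))
      + z * subgraphSum x y z (mkG k (removeVertex (removeVertex ((u , v) ∷ L) u) v')) ∎
    where
    S≈E = subgraphSum≈expansion
    open ProperEdge u v u≢v using (v'; removeUV)
    open Merge u v u≢v using (mergeAll)

  subgraphSum-edgeless : ∀ n → subgraphSum x y z (mkG n []) ≈ pow x n
  subgraphSum-edgeless n = begin
    subgraphSum x y z (mkG n [])      ≈⟨ subgraphSum≈expansion n [] ⟩
    expansion {n} []                  ≈⟨ trans (sumSub-[] (λ A → sumSub [] (weight {n} A))) (sumSub-[] (weight {n} [])) ⟩
    weight {n} [] []                  ≈⟨ reflexive (P.cong (λ b → if b then monomial (kSpan {n} []) 0 (kCov {n} []) else 0#)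
                                                           (djB⇐ {n} [] [] (λ _ ()))) ⟩
    monomial (kSpan {n} []) 0 (kCov {n} [])
                                      ≈⟨ monomial-≡ (kSpan-[] n) P.refl no-covered-components ⟩
    monomial n 0 0                    ≈⟨ trans (*-identityʳ _) (*-identityʳ _) ⟩
    pow x n                           ∎
    where
    no-covered-components : kCov {n} [] ≡ 0
    no-covered-components = countV-false _ (λ v → P.cong (_∧ isRep {n} [] v) (covered-lookup {n} [] v))

  recurrent-unique : ∀ (f g : Graph → Carrier) → RecurrentAtFirstEdge f → RecurrentAtFirstEdge g →
    (∀ n → f (mkG n []) ≈ g (mkG n [])) → ∀ G → f G ≈ g G
  recurrent-unique f g rec-f rec-g edgeless G₀ = agree (length (edges G₀)) G₀ ℕP.≤-refl
    where
    agree : ∀ m G → length (edges G) ≤ m → f G ≈ g G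
    agree m (mkG n []) _ = edgeless n
    agree (suc m) (mkG n ((u , v) ∷ L)) (ℕ.s≤s |L|≤m) = begin
      f G                                                                  ≈⟨ rec-f n u v L ⟩
      f (delete G zero) + y * f (contract G zero) + z * f (dagger G zero)
        ≈⟨ +-cong (+-cong (agree m (mkG n L) |L|≤m)
                          (*-congˡ (agree m _ (ℕP.≤-trans (length-contract n u v L) |L|≤m))))
                  (*-congˡ (agree m _ (ℕP.≤-trans (length-dagger n u v L) |L|≤m))) ⟩
      g (delete G zero) + y * g (contract G zero) + z * g (dagger G zero) ≈⟨ sym (rec-g n u v L) ⟩
      g G                                                                  ∎
      where G = mkG n ((u , v) ∷ L)

theorem2 : ∀ {c ℓ} (R : CommutativeRing c ℓ) →
    let open CommutativeRing R in
    (x y z : Carrier) (ξ : Graph → Carrier) →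
    (∀ (G : Graph) (e : Edge G) →
    ξ G ≈ ξ (delete G e) + y * ξ (contract G e) + z * ξ (dagger G e)) →
    (∀ (G₁ G₂ : Graph) → ξ (G₁ ⊕ G₂) ≈ ξ G₁ * ξ G₂) →
    ξ E₁ ≈ x →
    ξ G∅ ≈ 1# →
    ∀ (G : Graph) → ξ G ≈ Expansion.subgraphSum R x y z G
theorem2 R x y z ξ deletion-contraction multiplicative ξ-E₁ ξ-∅ =
  recurrent-unique ξ (subgraphSum x y z) (λ n u v L → deletion-contraction (mkG n ((u , v) ∷ L)) zero)
    subgraphSum-recurrent (λ n → trans (ξ-edgeless n) (sym (subgraphSum-edgeless n)))
  where
  open CommutativeRing R hiding (zero)
  open Expansion R using (pow; subgraphSum)
  open Recurrence R x y z using (recurrent-unique; subgraphSum-recurrent; subgraphSum-edgeless)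
  -- ξ(edgeless graph on n vertices) = ξ(E₁ ⊕ ... ⊕ E₁) = x^n
  ξ-edgeless : ∀ n → ξ (mkG n []) ≈ pow x n
  ξ-edgeless zero    = ξ-∅
  ξ-edgeless (suc n) = trans (multiplicative E₁ (mkG n [])) (*-cong ξ-E₁ (ξ-edgeless n))
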